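{- Let $G = C_l$ be a cycle with $l \geq 3$, let $m \geq 2$, and let $\mathcal{H}=(L,H)$ be an arbitrary $m$-fold cover of $G$. Then for every $v \in V(G)$ and every $r \in L(v)$, $N(r,\mathcal{H}) \geq P_{DP}(G,m)/m$.
   Context: All graphs are finite and simple. A cover of a graph $G$ is a pair $\mathcal{H}=(L,H)$ where $H$ is a graph and $L: V(G) \to \mathcal{P}(V(H))$ satisfies: (1) $\{L(u): u \in V(G)\}$ is a partition of $V(H)$ into $|V(G)|$ parts; (2) $H[L(u)]$ is complete for each $u$; (3) if there is an edge of $H$ between $L(u)$ and $L(v)$ with $u \neq v$, then $uv \in E(G)$; (4) if $uv \in E(G)$, the edges of $H$ between $L(u)$ and $L(v)$ form a (possibly empty) matching. The cover is $m$-fold if $|L(u)|=m$ for all $u$. An $\mathcal{H}$-coloring of $G$ is an independent set of $H$ of size $|V(G)|$. $P_{DP}(G,m)$ is the minimum number of $\mathcal{H}$-colorings over all $m$-fold covers. $N(r,\mathcal{H})$ is the number of $\mathcal{H}$-colorings containing the vertex $r$. -}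

module Defs where

open import Data.Bool using (Bool; true; false; _∧_; not; if_then_else_)
open import Data.Nat using (ℕ; zero; suc; _+_; _*_; _≤_; _%_; _≡ᵇ_)
open import Data.Fin using (Fin; toℕ)
open import Data.Fin.Properties using () renaming (_≟_ to _≟ᶠ_)
open import Data.Fin.Subset using (Subset; inside; outside; ∣_∣; _∈_)
open import Data.List using (List; []; _∷_; map; _++_; length; filter; filterᵇ; allFin; concatMap)
open import Data.Bool.ListAction using (and)
open import Data.Vec using (Vec; []; _∷_; lookup)
open import Data.Product using (Σ; _×_; _,_)
open import Relation.Binary.PropositionalEquality using (_≡_; _≢_)

cycleAdj : (l : ℕ) → Fin l → Fin l → Bool
cycleAdj l i j with l
... | zero = false
... | suc k = (((toℕ i + 1) % suc k) ≡ᵇ toℕ j) Data.Bool.∨ (((toℕ j + 1) % suc k) ≡ᵇ toℕ i)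

-- H has vertex set Fin N with Boolean adjacency adj (a simple graph);
-- L(u) = { x | part x ≡ u }, so {L(u)} is a partition of V(H) indexed by V(G).
record Cover (n : ℕ) (adjG : Fin n → Fin n → Bool) (m : ℕ) : Set where
  field
    N        : ℕ
    adj      : Fin N → Fin N → Bool
    part     : Fin N → Fin n
    irrefl   : ∀ x → adj x x ≡ false
    sym      : ∀ x y → adj x y ≡ adj y x
    foldSize : ∀ u → length (filter (λ x → part x ≟ᶠ u) (allFin N)) ≡ m
    clique   : ∀ x y → x ≢ y → part x ≡ part y → adj x y ≡ true
    onEdges  : ∀ x y → part x ≢ part y → adj x y ≡ true → adjG (part x) (part y) ≡ true
    matching : ∀ x y z → part x ≢ part y → part y ≡ part z →
               adj x y ≡ true → adj x z ≡ true → y ≡ z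

allSubsets : (N : ℕ) → List (Subset N)
allSubsets zero = [] ∷ []
allSubsets (suc N) = concatMap (λ s → (inside ∷ s) ∷ (outside ∷ s) ∷ []) (allSubsets N)

memᵇ : ∀ {N} → Fin N → Subset N → Bool
memᵇ x s with lookup s x
... | inside = true
... | outside = false

independentᵇ : ∀ {N} → (Fin N → Fin N → Bool) → Subset N → Bool
independentᵇ {N} adj s =
  and (concatMap (λ x → map (λ y → not (memᵇ x s ∧ memᵇ y s ∧ adj x y)) (allFin N)) (allFin N))

module _ {n : ℕ} {adjG : Fin n → Fin n → Bool} {m : ℕ} (𝓗 : Cover n adjG m) where
  open Cover 𝓗

  isColoringᵇ : Subset N → Bool
  isColoringᵇ s = independentᵇ adj s ∧ (∣ s ∣ ≡ᵇ n)

  colorings : List (Subset N)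
  colorings = filterᵇ isColoringᵇ (allSubsets N)

  numColorings : ℕ
  numColorings = length colorings

  Nr : Fin N → ℕ
  Nr r = length (filterᵇ (memᵇ r) colorings)

IsPDP : (n : ℕ) (adjG : Fin n → Fin n → Bool) (m : ℕ) → ℕ → Set
IsPDP n adjG m p =
  Σ (Cover n adjG m) (λ 𝓗 → numColorings 𝓗 ≡ p) × (∀ (𝓗 : Cover n adjG m) → p ≤ numColorings 𝓗)

module Submission where

-- Write v = u₀, u₁, …, u_l = v for the vertices of the cycle in order. An 𝓗-coloring containing
-- r ∈ L(v) is the same as a closed walk r = x₀, x₁, …, x_l = r with x_i ∈ L(u_i) and consecutive
-- entries nonadjacent, so N(r, 𝓗) counts such walks. Each vertex has at most one neighbour in the
-- next part, so counting level by level, at every level one distinguished vertex ends at least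
-- walksSame m k walks and every other vertex at least walksOther m k; hence N(r, 𝓗) is at least the
-- minimum of the two at level l. In the product cover of C_l by m colours, twisted on one edge by a
-- cyclic shift of the colours when that is better, every vertex of L(v) lies on at most this minimum
-- number of closed walks, so P_DP(C_l, m) ≤ m · min ≤ m · N(r, 𝓗).

open import Defs
open import Data.Nat using (ℕ; zero; suc; _+_; _*_; _∸_; _≤_; _<_; z≤n; s≤s; _≡ᵇ_; _%_; _<?_; _⊓_)
open import Data.Nat.Properties
open import Data.Nat.DivMod using (m%n<n; m<n⇒m%n≡m; m%n%n≡m%n; %-distribˡ-+; [m+n]%n≡m%n; m≤n⇒[n∸m]%m≡n%m)
open import Data.Nat.Tactic.RingSolver using (solve-∀)
open import Data.Bool using (Bool; true; false; _∧_; not; if_then_else_; T)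
open import Data.Bool.Properties using (T?; T-≡; ∧-conicalˡ; ∧-conicalʳ; ¬-not) renaming (_≟_ to _≟ᵇ_)
open import Data.Bool.ListAction using (and)
open import Data.Fin using (Fin; zero; suc; toℕ; fromℕ<; combine; remQuot)
open import Data.Fin.Subset using (Subset; ∣_∣)
open import Data.List using (List; []; _∷_; map; length; filter; filterᵇ; concatMap; allFin; tabulate; upTo)
open import Data.List.Properties using (length-map; length-++; length-filter; length-tabulate; length-upTo; filter-all)
open import Data.List.Membership.Propositional using (_∈_; _∉_; find; lose)
open import Data.List.Membership.Propositional.Properties
  using (∈-filter⁺; ∈-filter⁻; ∈-map⁺; ∈-map⁻; ∈-concatMap⁺; ∈-concatMap⁻; ∈-allFin; ∈-upTo⁻)
open import Data.List.Relation.Binary.Subset.Propositional using (_⊆_)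
open import Data.List.Relation.Unary.All as All using (All; []; _∷_)
open import Data.List.Relation.Unary.All.Properties using (¬Any⇒All¬)
open import Data.List.Relation.Unary.Any using (here; there; any?)
open import Data.List.Relation.Unary.AllPairs using ([]; _∷_)
open import Data.List.Relation.Unary.Unique.Propositional using (Unique)
import Data.List.Relation.Unary.Unique.Propositional.Properties as Unique
open import Data.Vec using (Vec; []; _∷_; lookup; toList; head)
import Data.Vec.Properties as Vec
import Data.Fin.Properties as Fin
open import Data.Product using (∃; _×_; _,_; proj₁; proj₂)
open import Data.Sum using (_⊎_; inj₁; inj₂)
open import Function using (_∘_; Equivalence)
open import Relation.Binary.Definitions using (DecidableEquality; tri<; tri≈; tri>)
open import Relation.Binary.PropositionalEquality
open import Relation.Nullary using (¬_; Dec; yes; no; does; ¬?; contradiction)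
open import Relation.Unary using (Decidable)

∑ : {A : Set} → List A → (A → ℕ) → ℕ
∑ []       f = 0
∑ (x ∷ xs) f = f x + ∑ xs f

module _ {A : Set} where

  ∑-mono-≤ : ∀ (xs : List A) {f g : A → ℕ} → (∀ {x} → x ∈ xs → f x ≤ g x) → ∑ xs f ≤ ∑ xs g
  ∑-mono-≤ []       _ = z≤n
  ∑-mono-≤ (x ∷ xs) h = +-mono-≤ (h (here refl)) (∑-mono-≤ xs (h ∘ there))

  ∑-cong : ∀ (xs : List A) {f g : A → ℕ} → (∀ {x} → x ∈ xs → f x ≡ g x) → ∑ xs f ≡ ∑ xs g
  ∑-cong []       _ = refl
  ∑-cong (x ∷ xs) h = cong₂ _+_ (h (here refl)) (∑-cong xs (h ∘ there))

  ∑-const : ∀ (xs : List A) b → ∑ xs (λ _ → b) ≡ length xs * b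
  ∑-const []       b = refl
  ∑-const (x ∷ xs) b = cong (b +_) (∑-const xs b)

  ∑-≤-const : ∀ (xs : List A) {f : A → ℕ} {b} → (∀ {x} → x ∈ xs → f x ≤ b) → ∑ xs f ≤ length xs * b
  ∑-≤-const xs {b = b} h = ≤-trans (∑-mono-≤ xs h) (≤-reflexive (∑-const xs b))

  ∑-≥-const : ∀ (xs : List A) {f : A → ℕ} {b} → (∀ {x} → x ∈ xs → b ≤ f x) → length xs * b ≤ ∑ xs f
  ∑-≥-const xs {b = b} h = ≤-trans (≤-reflexive (sym (∑-const xs b))) (∑-mono-≤ xs h)

  ∑-≥-term : ∀ (xs : List A) (f : A → ℕ) {x} → x ∈ xs → f x ≤ ∑ xs f
  ∑-≥-term (y ∷ xs) f (here refl) = m≤m+n (f y) _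
  ∑-≥-term (y ∷ xs) f (there x∈) = ≤-trans (∑-≥-term xs f x∈) (m≤n+m _ (f y))

  ∑-+ : ∀ (xs : List A) (f g : A → ℕ) → ∑ xs (λ x → f x + g x) ≡ ∑ xs f + ∑ xs g
  ∑-+ []       f g = refl
  ∑-+ (x ∷ xs) f g rewrite ∑-+ xs f g = shuffle (f x) (g x) (∑ xs f) (∑ xs g)
    where
    shuffle : ∀ a b c d → (a + b) + (c + d) ≡ (a + c) + (b + d)
    shuffle = solve-∀

  module _ {P : A → Set} (P? : Decidable P) where

    ∑-partition : ∀ (xs : List A) (f : A → ℕ) → ∑ xs f ≡ ∑ (filter P? xs) f + ∑ (filter (¬? ∘ P?) xs) f
    ∑-partition []       f = refl
    ∑-partition (x ∷ xs) f with P? x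
    ... | yes _ = trans (cong (f x +_) (∑-partition xs f)) (sym (+-assoc (f x) _ _))
    ... | no  _ = trans (cong (f x +_) (∑-partition xs f)) (swap (f x) (∑ (filter P? xs) f) (∑ (filter (¬? ∘ P?) xs) f))
      where
      swap : ∀ a b c → a + (b + c) ≡ b + (a + c)
      swap = solve-∀

    ∑-filter : ∀ (xs : List A) (f : A → ℕ) → ∑ xs (λ x → if does (P? x) then f x else 0) ≡ ∑ (filter P? xs) f
    ∑-filter []       f = refl
    ∑-filter (x ∷ xs) f with P? x
    ... | yes _ = cong (f x +_) (∑-filter xs f)
    ... | no  _ = ∑-filter xs f

    length-partition : ∀ (xs : List A) → length (filter P? xs) + length (filter (¬? ∘ P?) xs) ≡ length xs
    length-partition xs = trans (sym (cong₂ _+_ (ones (filter P? xs)) (ones (filter (¬? ∘ P?) xs))))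
                                (trans (sym (∑-partition xs (λ _ → 1))) (ones xs))
      where
      ones : ∀ ys → ∑ ys (λ _ → 1) ≡ length ys
      ones ys = trans (∑-const ys 1) (*-identityʳ (length ys))

length-concatMap : {A B : Set} (f : A → List B) (xs : List A) → length (concatMap f xs) ≡ ∑ xs (length ∘ f)
length-concatMap f []       = refl
length-concatMap f (x ∷ xs) = trans (length-++ (f x)) (cong (length (f x) +_) (length-concatMap f xs))

Unique-concatMap⁺ : {A B : Set} (f : A → List B) {xs : List A} → Unique xs → (∀ {x} → x ∈ xs → Unique (f x)) →
  (∀ {x y z} → x ∈ xs → y ∈ xs → z ∈ f x → z ∈ f y → x ≡ y) → Unique (concatMap f xs)
Unique-concatMap⁺ f {[]}     _          _    _    = []
Unique-concatMap⁺ f {x ∷ xs} (x∉ ∷ xs!) uniq disj =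
  Unique.++⁺ (uniq (here refl)) (Unique-concatMap⁺ f xs! (uniq ∘ there) (λ a b → disj (there a) (there b)))
    λ (z∈fx , z∈rest) → let (y , y∈ , z∈fy) = find (∈-concatMap⁻ f {xs} z∈rest) in
      All.lookup x∉ y∈ (disj (here refl) (there y∈) z∈fx z∈fy)

module _ {A : Set} (_≟_ : DecidableEquality A) where

  remove : A → List A → List A
  remove x = filter (λ y → ¬? (y ≟ x))

  ∈-remove⁺ : ∀ {x y ys} → y ∈ ys → y ≢ x → y ∈ remove x ys
  ∈-remove⁺ = ∈-filter⁺ (λ y → ¬? (y ≟ _))

  ∈-remove⁻ : ∀ {x y} ys → y ∈ remove x ys → y ∈ ys × y ≢ x
  ∈-remove⁻ ys = ∈-filter⁻ (λ y → ¬? (y ≟ _)) {xs = ys}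

  length-remove-<  : ∀ {x} ys → x ∈ ys → length (remove x ys) < length ys
  length-remove-< {x} (y ∷ ys) (here refl) with y ≟ y
  ... | yes _ = s≤s (length-filter (λ z → ¬? (z ≟ y)) ys)
  ... | no y≢y = contradiction refl y≢y
  length-remove-< {x} (y ∷ ys) (there x∈) with y ≟ x
  ... | yes _ = s≤s (length-filter (λ z → ¬? (z ≟ x)) ys)
  ... | no _ = s≤s (length-remove-< ys x∈)

  length-remove-∉ : ∀ {x} ys → x ∉ ys → length (remove x ys) ≡ length ys
  length-remove-∉ ys x∉ =
    cong length (filter-all (λ y → ¬? (y ≟ _)) (All.tabulate λ y∈ y≡x → x∉ (subst (_∈ ys) y≡x y∈)))

  length-remove-∈ : ∀ {x} ys → Unique ys → x ∈ ys → suc (length (remove x ys)) ≡ length ys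
  length-remove-∈ (y ∷ ys) (y∉ ∷ _) (here refl) with y ≟ y
  ... | yes _ = cong suc (length-remove-∉ ys λ y∈ → All.lookup y∉ y∈ refl)
  ... | no y≢y = contradiction refl y≢y
  length-remove-∈ {x} (y ∷ ys) (y∉ ∷ ys!) (there x∈) with y ≟ x
  ... | yes refl = contradiction refl (All.lookup y∉ x∈)
  ... | no _ = cong suc (length-remove-∈ ys ys! x∈)

  Unique-⊆⇒length≤ : ∀ {xs ys : List A} → Unique xs → xs ⊆ ys → length xs ≤ length ys
  Unique-⊆⇒length≤ {[]}     _          _   = z≤n
  Unique-⊆⇒length≤ {x ∷ xs} {ys} (x∉ ∷ xs!) xs⊆ys =
    ≤-trans (s≤s (Unique-⊆⇒length≤ xs! xs⊆ys-x)) (length-remove-< ys (xs⊆ys (here refl)))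
    where
    xs⊆ys-x : xs ⊆ remove x ys
    xs⊆ys-x z∈ = ∈-remove⁺ (xs⊆ys (there z∈)) (All.lookup x∉ z∈ ∘ sym)

  Unique-map⁺-on : ∀ {B : Set} (f : A → B) {xs} → Unique xs →
    (∀ {a b} → a ∈ xs → b ∈ xs → f a ≡ f b → a ≡ b) → Unique (map f xs)
  Unique-map⁺-on f {[]}     _          _   = []
  Unique-map⁺-on f {x ∷ xs} (x∉ ∷ xs!) inj =
    All.tabulate fx∉ ∷ Unique-map⁺-on f xs! (λ a b → inj (there a) (there b))
    where
    fx∉ : ∀ {z} → z ∈ map f xs → f x ≢ z
    fx∉ z∈ fx≡z with ∈-map⁻ f z∈
    ... | a , a∈ , refl = All.lookup x∉ a∈ (inj (here refl) (there a∈) fx≡z)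

Unique-allEqual⇒length≤1 : {A : Set} {xs : List A} → Unique xs → (∀ {a b} → a ∈ xs → b ∈ xs → a ≡ b) → length xs ≤ 1
Unique-allEqual⇒length≤1 {xs = []}       _          _ = z≤n
Unique-allEqual⇒length≤1 {xs = x ∷ []}   _          _ = s≤s z≤n
Unique-allEqual⇒length≤1 {xs = x ∷ y ∷ xs} (x∉ ∷ _) eq = contradiction (eq (here refl) (there (here refl))) (All.lookup x∉ (here refl))

module _ {A B : Set} (_≟A_ : DecidableEquality A) (_≟B_ : DecidableEquality B) where

  injective-on⇒length≤ : ∀ (f : A → B) {xs ys} → Unique xs → (∀ {a} → a ∈ xs → f a ∈ ys) →
    (∀ {a b} → a ∈ xs → b ∈ xs → f a ≡ f b → a ≡ b) → length xs ≤ length ys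
  injective-on⇒length≤ f {xs} {ys} xs! into inj =
    ≤-trans (≤-reflexive (sym (length-map f xs)))
            (Unique-⊆⇒length≤ _≟B_ (Unique-map⁺-on _≟A_ f xs! inj) fxs⊆ys)
    where
    fxs⊆ys : map f xs ⊆ ys
    fxs⊆ys z∈ with ∈-map⁻ f z∈
    ... | a , a∈ , refl = into a∈

Unique-length⇒complete : ∀ {n} (xs : List (Fin n)) → Unique xs → n ≤ length xs → ∀ w → w ∈ xs
Unique-length⇒complete {n} xs xs! n≤ w with any? (w Fin.≟_) xs
... | yes w∈ = w∈
... | no w∉ = contradiction n≤ (<⇒≱ (begin-strict
      length xs                         ≤⟨ Unique-⊆⇒length≤ Fin._≟_ xs! xs⊆ ⟩
      length (remove Fin._≟_ w (allFin n)) <⟨ length-remove-< Fin._≟_ (allFin n) (∈-allFin w) ⟩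
      length (allFin n)                 ≡⟨ length-tabulate (λ x → x) ⟩
      n                                 ∎))
  where
  open ≤-Reasoning
  xs⊆ : xs ⊆ remove Fin._≟_ w (allFin n)
  xs⊆ {z} z∈ = ∈-remove⁺ Fin._≟_ (∈-allFin z) (λ z≡w → w∉ (subst (_∈ xs) z≡w z∈))

module _ {A : Set} (_≟_ : DecidableEquality A) where

  ∑-remove : ∀ (xs : List A) t (f : A → ℕ) → ∑ xs f ≡ ∑ (filter (_≟ t) xs) f + ∑ (remove _≟_ t xs) f
  ∑-remove xs t = ∑-partition (_≟ t) xs

  ∑-≥-others : ∀ (xs : List A) t (f : A → ℕ) {b} → (∀ {y} → y ∈ xs → y ≢ t → b ≤ f y) →
    length (remove _≟_ t xs) * b ≤ ∑ xs f
  ∑-≥-others xs t f {b} h = begin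
    length (remove _≟_ t xs) * b                   ≤⟨ ∑-≥-const (remove _≟_ t xs) (λ y∈ → let (y∈xs , y≢t) = ∈-remove⁻ _≟_ xs y∈ in h y∈xs y≢t) ⟩
    ∑ (remove _≟_ t xs) f                          ≤⟨ m≤n+m _ _ ⟩
    ∑ (filter (_≟ t) xs) f + ∑ (remove _≟_ t xs) f ≡⟨ sym (∑-remove xs t f) ⟩
    ∑ xs f                                         ∎
    where open ≤-Reasoning

  ∑-≥-special+others : ∀ (xs : List A) t (f : A → ℕ) {a b} → t ∈ xs → a ≤ f t →
    (∀ {y} → y ∈ xs → y ≢ t → b ≤ f y) → a + length (remove _≟_ t xs) * b ≤ ∑ xs f
  ∑-≥-special+others xs t f t∈ a≤ h = begin
    _ + length (remove _≟_ t xs) * _               ≤⟨ +-mono-≤ (≤-trans a≤ (∑-≥-term _ f (∈-filter⁺ (_≟ t) t∈ refl)))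
                                                              (∑-≥-const (remove _≟_ t xs) (λ y∈ → let (y∈xs , y≢t) = ∈-remove⁻ _≟_ xs y∈ in h y∈xs y≢t)) ⟩
    ∑ (filter (_≟ t) xs) f + ∑ (remove _≟_ t xs) f ≡⟨ sym (∑-remove xs t f) ⟩
    ∑ xs f                                         ∎
    where open ≤-Reasoning

  ∑-≤-special+others : ∀ (xs : List A) t (f : A → ℕ) {a b} → Unique xs → (t ∈ xs → f t ≤ a) →
    (∀ {y} → y ∈ xs → y ≢ t → f y ≤ b) → ∑ xs f ≤ a + length (remove _≟_ t xs) * b
  ∑-≤-special+others xs t f {a} {b} xs! ≤a h = begin
    ∑ xs f                                         ≡⟨ ∑-remove xs t f ⟩
    ∑ (filter (_≟ t) xs) f + ∑ (remove _≟_ t xs) f ≤⟨ +-mono-≤ (at-most-t (filter (_≟ t) xs) (Unique.filter⁺ (_≟ t) xs!) (∈-filter⁻ (_≟ t)))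
                                                              (∑-≤-const (remove _≟_ t xs) (λ y∈ → let (y∈xs , y≢t) = ∈-remove⁻ _≟_ xs y∈ in h y∈xs y≢t)) ⟩
    a + length (remove _≟_ t xs) * b               ∎
    where
    open ≤-Reasoning
    at-most-t : ∀ ts → Unique ts → (∀ {y} → y ∈ ts → y ∈ xs × y ≡ t) → ∑ ts f ≤ a
    at-most-t []           _          _  = z≤n
    at-most-t (y ∷ [])     _          ts⊆ with ts⊆ (here refl)
    ... | y∈ , refl = ≤-trans (≤-reflexive (+-identityʳ (f y))) (≤a y∈)
    at-most-t (y ∷ z ∷ _) (y∉ ∷ _) ts⊆ =
      contradiction (trans (proj₂ (ts⊆ (here refl))) (sym (proj₂ (ts⊆ (there (here refl)))))) (All.lookup y∉ (here refl))

≡ᵇ-true⁺ : ∀ {a b} → a ≡ b → (a ≡ᵇ b) ≡ true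
≡ᵇ-true⁺ {a} {b} a≡b = Equivalence.to T-≡ (≡⇒≡ᵇ a b a≡b)

≡ᵇ-true⁻ : ∀ {a b} → (a ≡ᵇ b) ≡ true → a ≡ b
≡ᵇ-true⁻ {a} {b} eq = ≡ᵇ⇒≡ a b (subst T (sym eq) _)

module _ {A : Set} (p : A → Bool) where

  ∈-filterᵇ⁺ : ∀ {x xs} → x ∈ xs → p x ≡ true → x ∈ filterᵇ p xs
  ∈-filterᵇ⁺ x∈ px = ∈-filter⁺ (T? ∘ p) x∈ (subst T (sym px) _)

  ∈-filterᵇ⁻ : ∀ {x} xs → x ∈ filterᵇ p xs → x ∈ xs × p x ≡ true
  ∈-filterᵇ⁻ xs x∈ with ∈-filter⁻ (T? ∘ p) {xs = xs} x∈
  ... | x∈xs , px = x∈xs , Equivalence.to T-≡ px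

and≡true⁻ : ∀ (bs : List Bool) → and bs ≡ true → ∀ {b} → b ∈ bs → b ≡ true
and≡true⁻ (true  ∷ bs) _  (here refl) = refl
and≡true⁻ (true  ∷ bs) eq (there b∈)  = and≡true⁻ bs eq b∈
and≡true⁻ (false ∷ bs) ()

and≡true⁺ : ∀ (bs : List Bool) → (∀ {b} → b ∈ bs → b ≡ true) → and bs ≡ true
and≡true⁺ []       _ = refl
and≡true⁺ (b ∷ bs) h rewrite h (here refl) = and≡true⁺ bs (h ∘ there)

∈-allSubsets : ∀ N (s : Subset N) → s ∈ allSubsets N
∈-allSubsets zero    []      = here refl
∈-allSubsets (suc N) (b ∷ s) = ∈-concatMap⁺ (λ s → (true ∷ s) ∷ (false ∷ s) ∷ []) (lose (∈-allSubsets N s) (extensions b))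
  where
  extensions : ∀ b → (b ∷ s) ∈ (true ∷ s) ∷ (false ∷ s) ∷ []
  extensions true  = here refl
  extensions false = there (here refl)

Unique-allSubsets : ∀ N → Unique (allSubsets N)
Unique-allSubsets zero    = [] ∷ []
Unique-allSubsets (suc N) =
  Unique-concatMap⁺ (λ s → (true ∷ s) ∷ (false ∷ s) ∷ []) (Unique-allSubsets N) (λ _ → ((λ ()) ∷ []) ∷ [] ∷ []) disjoint
  where
  disjoint : ∀ {s s' z} → s ∈ allSubsets N → s' ∈ allSubsets N →
    z ∈ (true ∷ s) ∷ (false ∷ s) ∷ [] → z ∈ (true ∷ s') ∷ (false ∷ s') ∷ [] → s ≡ s'
  disjoint _ _ (here refl)         (here refl)         = refl
  disjoint _ _ (there (here refl)) (there (here refl)) = refl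
  disjoint _ _ (here refl)         (there (here ()))
  disjoint _ _ (there (here refl)) (here ())

module _ {N : ℕ} where

  memᵇ≡lookup : ∀ (x : Fin N) s → memᵇ x s ≡ lookup s x
  memᵇ≡lookup x s with lookup s x
  ... | true  = refl
  ... | false = refl

  memᵇ-ext : ∀ {s s' : Subset N} → (∀ x → memᵇ x s ≡ memᵇ x s') → s ≡ s'
  memᵇ-ext {s} {s'} h = begin
    s                       ≡⟨ Vec.tabulate∘lookup s ⟨
    Data.Vec.tabulate (lookup s)  ≡⟨ Vec.tabulate-cong (λ x → trans (sym (memᵇ≡lookup x s)) (trans (h x) (memᵇ≡lookup x s'))) ⟩
    Data.Vec.tabulate (lookup s') ≡⟨ Vec.tabulate∘lookup s' ⟩
    s'                      ∎
    where open ≡-Reasoning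

  elements : Subset N → List (Fin N)
  elements s = filterᵇ (λ x → memᵇ x s) (allFin N)

  ∈-elements⁺ : ∀ {x} s → memᵇ x s ≡ true → x ∈ elements s
  ∈-elements⁺ {x} s = ∈-filterᵇ⁺ (λ x → memᵇ x s) (∈-allFin x)

  ∈-elements⁻ : ∀ {x} s → x ∈ elements s → memᵇ x s ≡ true
  ∈-elements⁻ s x∈ = proj₂ (∈-filterᵇ⁻ (λ x → memᵇ x s) (allFin N) x∈)

  Unique-elements : ∀ s → Unique (elements s)
  Unique-elements s = Unique.filter⁺ (T? ∘ λ x → memᵇ x s) (Unique.allFin⁺ N)

  ∣∣≡length-elements : ∀ s → ∣ s ∣ ≡ length (elements s)
  ∣∣≡length-elements s = sym (count N s (λ x → x) (λ i → memᵇ≡lookup i s))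
    where
    count : ∀ {X : Set} {p : X → Bool} n (t : Subset n) (f : Fin n → X) → (∀ i → p (f i) ≡ lookup t i) →
      length (filterᵇ p (tabulate f)) ≡ ∣ t ∣
    count zero    []      f h = refl
    count {p = p} (suc n) (b ∷ t) f h with p (f zero) | h zero
    ... | true  | refl = cong suc (count n t (f ∘ suc) (h ∘ suc))
    ... | false | refl = count n t (f ∘ suc) (h ∘ suc)

  setOf : List (Fin N) → Subset N
  setOf xs = Data.Vec.tabulate (λ x → does (any? (x Fin.≟_) xs))

  memᵇ-setOf⁺ : ∀ {x xs} → x ∈ xs → memᵇ x (setOf xs) ≡ true
  memᵇ-setOf⁺ {x} {xs} x∈ rewrite memᵇ≡lookup x (setOf xs) | Vec.lookup∘tabulate (λ x → does (any? (x Fin.≟_) xs)) x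
    with any? (x Fin.≟_) xs
  ... | yes _  = refl
  ... | no x∉ = contradiction x∈ x∉

  memᵇ-setOf⁻ : ∀ {x xs} → memᵇ x (setOf xs) ≡ true → x ∈ xs
  memᵇ-setOf⁻ {x} {xs} x∈ rewrite memᵇ≡lookup x (setOf xs) | Vec.lookup∘tabulate (λ x → does (any? (x Fin.≟_) xs)) x
    with any? (x Fin.≟_) xs
  ... | yes x∈xs = x∈xs

  ∣setOf∣ : ∀ {xs} → Unique xs → ∣ setOf xs ∣ ≡ length xs
  ∣setOf∣ {xs} xs! = trans (∣∣≡length-elements (setOf xs)) (≤-antisym
    (Unique-⊆⇒length≤ Fin._≟_ {elements (setOf xs)} {xs} (Unique-elements (setOf xs)) (memᵇ-setOf⁻ ∘ ∈-elements⁻ (setOf xs)))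
    (Unique-⊆⇒length≤ Fin._≟_ {xs} {elements (setOf xs)} xs! (∈-elements⁺ (setOf xs) ∘ memᵇ-setOf⁺)))

  module _ (adj : Fin N → Fin N → Bool) (s : Subset N) where

    private
      pairTests : List Bool
      pairTests = concatMap (λ x → map (λ y → not (memᵇ x s ∧ memᵇ y s ∧ adj x y)) (allFin N)) (allFin N)

    independentᵇ-sound : independentᵇ adj s ≡ true → ∀ {x y} → memᵇ x s ≡ true → memᵇ y s ≡ true → adj x y ≡ false
    independentᵇ-sound indep {x} {y} x∈ y∈ with and≡true⁻ pairTests indep
      (∈-concatMap⁺ _ (lose (∈-allFin x) (∈-map⁺ (λ y → not (memᵇ x s ∧ memᵇ y s ∧ adj x y)) (∈-allFin y))))
    ... | test rewrite x∈ | y∈ with adj x y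
    ...   | false = refl

    independentᵇ-complete : (∀ {x y} → memᵇ x s ≡ true → memᵇ y s ≡ true → adj x y ≡ false) → independentᵇ adj s ≡ true
    independentᵇ-complete h = and≡true⁺ pairTests test
      where
      test : ∀ {b} → b ∈ pairTests → b ≡ true
      test b∈ with find (∈-concatMap⁻ _ {allFin N} b∈)
      ... | x , _ , b∈' with ∈-map⁻ (λ y → not (memᵇ x s ∧ memᵇ y s ∧ adj x y)) b∈'
      ... | y , _ , refl with memᵇ x s in x∈ | memᵇ y s in y∈
      ... | false | _     = refl
      ... | true  | false = refl
      ... | true  | true  rewrite h x∈ y∈ = refl

module CoverFacts {n : ℕ} {adjG : Fin n → Fin n → Bool} {m : ℕ} (𝓗 : Cover n adjG m) where
  open Cover 𝓗 renaming (sym to adj-sym)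

  fibre : Fin n → List (Fin N)
  fibre u = filter (λ x → part x Fin.≟ u) (allFin N)

  ∈-fibre⁺ : ∀ {u x} → part x ≡ u → x ∈ fibre u
  ∈-fibre⁺ {u} {x} = ∈-filter⁺ (λ x → part x Fin.≟ u) (∈-allFin x)

  ∈-fibre⁻ : ∀ {u x} → x ∈ fibre u → part x ≡ u
  ∈-fibre⁻ {u} x∈ = proj₂ (∈-filter⁻ (λ x → part x Fin.≟ u) {xs = allFin N} x∈)

  Unique-fibre : ∀ u → Unique (fibre u)
  Unique-fibre u = Unique.filter⁺ (λ x → part x Fin.≟ u) (Unique.allFin⁺ N)

  coloringsThrough : Fin N → List (Subset N)
  coloringsThrough r = filterᵇ (memᵇ r) (colorings 𝓗)

  Unique-coloringsThrough : ∀ r → Unique (coloringsThrough r)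
  Unique-coloringsThrough r =
    Unique.filter⁺ (T? ∘ memᵇ r) (Unique.filter⁺ (T? ∘ isColoringᵇ 𝓗) (Unique-allSubsets N))

  record IsColoringThrough (r : Fin N) (c : Subset N) : Set where
    field
      independent : independentᵇ adj c ≡ true
      size        : ∣ c ∣ ≡ n
      through     : memᵇ r c ≡ true

  ∈-coloringsThrough⁺ : ∀ {r c} → independentᵇ adj c ≡ true → ∣ c ∣ ≡ n → memᵇ r c ≡ true → c ∈ coloringsThrough r
  ∈-coloringsThrough⁺ {r} {c} indep size r∈c =
    ∈-filterᵇ⁺ (memᵇ r) (∈-filterᵇ⁺ (isColoringᵇ 𝓗) (∈-allSubsets N c) isColoring) r∈c
    where
    isColoring : isColoringᵇ 𝓗 c ≡ true
    isColoring rewrite indep = ≡ᵇ-true⁺ size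

  ∈-colorings⁻ : ∀ {c} → c ∈ colorings 𝓗 → independentᵇ adj c ≡ true × ∣ c ∣ ≡ n
  ∈-colorings⁻ {c} c∈ with ∈-filterᵇ⁻ (isColoringᵇ 𝓗) (allSubsets N) c∈
  ... | _ , isColoring = ∧-conicalˡ _ _ isColoring , ≡ᵇ-true⁻ (∧-conicalʳ _ _ isColoring)

  ∈-coloringsThrough⁻ : ∀ {r c} → c ∈ coloringsThrough r → IsColoringThrough r c
  ∈-coloringsThrough⁻ {r} {c} c∈ with ∈-filterᵇ⁻ (memᵇ r) (colorings 𝓗) c∈
  ... | c∈colorings , r∈c = record
    { independent = proj₁ (∈-colorings⁻ c∈colorings)
    ; size        = proj₂ (∈-colorings⁻ c∈colorings)
    ; through     = r∈c
    }

  module _ (c : Subset N) (indep : independentᵇ adj c ≡ true) where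

    coloring-injective-on-parts : ∀ {a b} → memᵇ a c ≡ true → memᵇ b c ≡ true → part a ≡ part b → a ≡ b
    coloring-injective-on-parts {a} {b} a∈ b∈ same with a Fin.≟ b
    ... | yes a≡b = a≡b
    ... | no  a≢b = contradiction (trans (sym (clique a b a≢b same)) (independentᵇ-sound adj c indep a∈ b∈)) λ ()

    coloring-meets-part : ∣ c ∣ ≡ n → ∀ u → ∃ λ x → memᵇ x c ≡ true × part x ≡ u
    coloring-meets-part size u with ∈-map⁻ part (Unique-length⇒complete (map part (elements c)) parts! n≤ u)
      where
      parts! : Unique (map part (elements c))
      parts! = Unique-map⁺-on Fin._≟_ part (Unique-elements c)
                 (λ a∈ b∈ → coloring-injective-on-parts (∈-elements⁻ c a∈) (∈-elements⁻ c b∈))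
      n≤ : n ≤ length (map part (elements c))
      n≤ = ≤-reflexive (sym (trans (length-map part (elements c)) (trans (sym (∣∣≡length-elements c)) size)))
    ... | x , x∈ , u≡ = x , ∈-elements⁻ c x∈ , sym u≡

  numColorings≤∑Nr : ∀ u → numColorings 𝓗 ≤ ∑ (fibre u) (Nr 𝓗)
  numColorings≤∑Nr u = count (colorings 𝓗) (λ c∈ → c∈)
    where
    meets : ∀ {c} → c ∈ colorings 𝓗 → ∃ λ x → memᵇ x c ≡ true × part x ≡ u
    meets {c} c∈ = let (indep , size) = ∈-colorings⁻ c∈ in coloring-meets-part c indep size u

    count : ∀ cs → (∀ {c} → c ∈ cs → c ∈ colorings 𝓗) → length cs ≤ ∑ (fibre u) (λ x → length (filterᵇ (memᵇ x) cs))
    count []       _  = z≤n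
    count (c ∷ cs) ⊆colorings with meets (⊆colorings (here refl))
    ... | x , x∈c , x∈u = begin
      suc (length cs)                                                  ≤⟨ +-mono-≤ one (count cs (⊆colorings ∘ there)) ⟩
      ∑ (fibre u) indicator + ∑ (fibre u) (λ x → length (filterᵇ (memᵇ x) cs)) ≡⟨ ∑-+ (fibre u) indicator _ ⟨
      ∑ (fibre u) (λ x → indicator x + length (filterᵇ (memᵇ x) cs))   ≡⟨ ∑-cong (fibre u) (λ {y} _ → step y) ⟩
      ∑ (fibre u) (λ x → length (filterᵇ (memᵇ x) (c ∷ cs)))           ∎
      where
      open ≤-Reasoning
      indicator : Fin N → ℕ
      indicator y = if memᵇ y c then 1 else 0
      one : 1 ≤ ∑ (fibre u) indicator
      one = subst (λ b → (if b then 1 else 0) ≤ ∑ (fibre u) indicator) x∈c (∑-≥-term (fibre u) indicator (∈-fibre⁺ x∈u))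
      step : ∀ y → indicator y + length (filterᵇ (memᵇ y) cs) ≡ length (filterᵇ (memᵇ y) (c ∷ cs))
      step y with memᵇ y c
      ... | true  = refl
      ... | false = refl

module CycleArithmetic (K : ℕ) where

  l : ℕ
  l = suc K

  next : Fin l → Fin l
  next w = fromℕ< (m%n<n (toℕ w + 1) l)

  rotate : Fin l → ℕ → Fin l
  rotate w zero    = w
  rotate w (suc i) = next (rotate w i)

  toℕ-rotate : ∀ w i → toℕ (rotate w i) ≡ (toℕ w + i) % l
  toℕ-rotate w zero    = sym (trans (cong (_% l) (+-identityʳ (toℕ w))) (m<n⇒m%n≡m (Fin.toℕ<n w)))
  toℕ-rotate w (suc i) = begin
    toℕ (next (rotate w i))           ≡⟨ Fin.toℕ-fromℕ< _ ⟩
    (toℕ (rotate w i) + 1) % l        ≡⟨ cong (λ t → (t + 1) % l) (toℕ-rotate w i) ⟩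
    ((toℕ w + i) % l + 1) % l         ≡⟨ %-distribˡ-+ ((toℕ w + i) % l) 1 l ⟩
    ((toℕ w + i) % l % l + 1 % l) % l ≡⟨ cong (λ t → (t + 1 % l) % l) (m%n%n≡m%n (toℕ w + i) l) ⟩
    ((toℕ w + i) % l + 1 % l) % l     ≡⟨ %-distribˡ-+ (toℕ w + i) 1 l ⟨
    (toℕ w + i + 1) % l               ≡⟨ cong (_% l) (trans (+-assoc (toℕ w) i 1) (cong (toℕ w +_) (+-comm i 1))) ⟩
    (toℕ w + suc i) % l               ∎
    where open ≡-Reasoning

  rotate-≢ : ∀ w {d} → 0 < d → d < l → rotate w d ≢ w
  rotate-≢ w {d} 0<d d<l eq with toℕ w + d <? l
  ... | yes small = <⇒≢ (m<m+n (toℕ w) 0<d) (sym (begin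
    toℕ w + d        ≡⟨ m<n⇒m%n≡m small ⟨
    (toℕ w + d) % l  ≡⟨ toℕ-rotate w d ⟨
    toℕ (rotate w d) ≡⟨ cong toℕ eq ⟩
    toℕ w            ∎))
    where open ≡-Reasoning
  ... | no big = <⇒≢ d<l (+-cancelˡ-≡ (toℕ w) d l (begin
    toℕ w + d            ≡⟨ m∸n+n≡m l≤ ⟨
    toℕ w + d ∸ l + l    ≡⟨ cong (_+ l) wrapped ⟩
    toℕ w + l            ∎))
    where
    open ≡-Reasoning
    l≤ : l ≤ toℕ w + d
    l≤ = ≮⇒≥ big
    wrapped : toℕ w + d ∸ l ≡ toℕ w
    wrapped = begin
      toℕ w + d ∸ l         ≡⟨ m<n⇒m%n≡m (m<n+o⇒m∸n<o (toℕ w + d) l (+-mono-< (Fin.toℕ<n w) d<l)) ⟨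
      (toℕ w + d ∸ l) % l   ≡⟨ m≤n⇒[n∸m]%m≡n%m l≤ ⟩
      (toℕ w + d) % l       ≡⟨ toℕ-rotate w d ⟨
      toℕ (rotate w d)      ≡⟨ cong toℕ eq ⟩
      toℕ w                 ∎

  rotate-l : ∀ w → rotate w l ≡ w
  rotate-l w = Fin.toℕ-injective (begin
    toℕ (rotate w l)  ≡⟨ toℕ-rotate w l ⟩
    (toℕ w + l) % l   ≡⟨ [m+n]%n≡m%n (toℕ w) l ⟩
    toℕ w % l         ≡⟨ m<n⇒m%n≡m (Fin.toℕ<n w) ⟩
    toℕ w             ∎)
    where open ≡-Reasoning

  rotate-+ : ∀ w i d → rotate w (i + d) ≡ rotate (rotate w i) d
  rotate-+ w i zero    = cong (rotate w) (+-identityʳ i)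
  rotate-+ w i (suc d) = trans (cong (rotate w) (+-suc i d)) (cong next (rotate-+ w i d))

  rotate-∸ : ∀ w {a b} → a ≤ b → rotate w b ≡ rotate (rotate w a) (b ∸ a)
  rotate-∸ w {a} {b} a≤b = trans (cong (rotate w) (sym (m+[n∸m]≡n a≤b))) (rotate-+ w a (b ∸ a))

  rotate-injective : ∀ w {i j} → i < l → j < l → rotate w i ≡ rotate w j → i ≡ j
  rotate-injective w {i} {j} i<l j<l eq with <-cmp i j
  ... | tri≈ _ i≡j _ = i≡j
  ... | tri< i<j _ _ = contradiction (sym (trans eq (rotate-∸ w (<⇒≤ i<j)))) (rotate-≢ (rotate w i) (m<n⇒0<n∸m i<j) (≤-trans (s≤s (m∸n≤m j i)) j<l))
  ... | tri> _ _ j<i = contradiction (sym (trans (sym eq) (rotate-∸ w (<⇒≤ j<i)))) (rotate-≢ (rotate w j) (m<n⇒0<n∸m j<i) (≤-trans (s≤s (m∸n≤m i j)) i<l))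

  next-injective : ∀ {a b} → next a ≡ next b → a ≡ b
  next-injective {a} {b} eq = begin
    a                   ≡⟨ rotate-l a ⟨
    rotate a (1 + K)    ≡⟨ rotate-+ a 1 K ⟩
    rotate (next a) K   ≡⟨ cong (λ w → rotate w K) eq ⟩
    rotate (next b) K   ≡⟨ rotate-+ b 1 K ⟨
    rotate b (1 + K)    ≡⟨ rotate-l b ⟩
    b                   ∎
    where open ≡-Reasoning

  rotate-surjective : ∀ w w' → ∃ λ i → i < l × rotate w i ≡ w'
  rotate-surjective w w' with ∈-map⁻ (rotate w) (Unique-length⇒complete (map (rotate w) (upTo l)) rotations! l≤ w')
    where
    rotations! : Unique (map (rotate w) (upTo l))
    rotations! = Unique-map⁺-on _≟_ (rotate w) (Unique.upTo⁺ l)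
                   (λ i∈ j∈ → rotate-injective w (∈-upTo⁻ i∈) (∈-upTo⁻ j∈))
    l≤ : l ≤ length (map (rotate w) (upTo l))
    l≤ = ≤-reflexive (sym (trans (length-map (rotate w) (upTo l)) (length-upTo l)))
  ... | i , i∈ , w'≡ = i , ∈-upTo⁻ i∈ , sym w'≡

  next⇒cycleAdj : ∀ {w w'} → next w ≡ w' → cycleAdj l w w' ≡ true
  next⇒cycleAdj {w} refl rewrite ≡ᵇ-true⁺ (sym (Fin.toℕ-fromℕ< (m%n<n (toℕ w + 1) l))) = refl

  next⇒cycleAdjʳ : ∀ {w w'} → next w' ≡ w → cycleAdj l w w' ≡ true
  next⇒cycleAdjʳ {w} {w'} refl with (toℕ w + 1) % l ≡ᵇ toℕ w'
  ... | true  = refl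
  ... | false rewrite ≡ᵇ-true⁺ (sym (Fin.toℕ-fromℕ< (m%n<n (toℕ w' + 1) l))) = refl

  cycleAdj⇒next : ∀ {w w'} → cycleAdj l w w' ≡ true → next w ≡ w' ⊎ next w' ≡ w
  cycleAdj⇒next {w} {w'} adj with (toℕ w + 1) % l ≡ᵇ toℕ w' in forward
  ... | true = inj₁ (Fin.toℕ-injective (trans (Fin.toℕ-fromℕ< _) (≡ᵇ-true⁻ forward)))
  ... | false with (toℕ w' + 1) % l ≡ᵇ toℕ w in backward
  ...   | true = inj₂ (Fin.toℕ-injective (trans (Fin.toℕ-fromℕ< _) (≡ᵇ-true⁻ backward)))

  next-≢ : 1 ≤ K → ∀ w → next w ≢ w
  next-≢ 1≤K w = rotate-≢ w {1} (s≤s z≤n) (s≤s 1≤K)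

  next²-≢ : 2 ≤ K → ∀ w → next (next w) ≢ w
  next²-≢ 2≤K w = rotate-≢ w {2} (s≤s z≤n) (s≤s 2≤K)

-- In the untwisted product cover, the numbers of walks of length k from a vertex of colour c to
-- the vertex of colour c, resp. to a given vertex of another colour, k parts further along.
mutual
  walksSame : ℕ → ℕ → ℕ
  walksSame m zero    = 1
  walksSame m (suc k) = (m ∸ 1) * walksOther m k

  walksOther : ℕ → ℕ → ℕ
  walksOther m zero    = 0
  walksOther m (suc k) = walksSame m k + (m ∸ 2) * walksOther m k

module Walks (K m : ℕ) (𝓗 : Cover (suc K) (cycleAdj (suc K)) m) (r : Fin (Cover.N 𝓗)) where
  open Cover 𝓗 renaming (sym to adj-sym)
  open CoverFacts 𝓗
  open CycleArithmetic K

  U : ℕ → Fin l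
  U = rotate (part r)

  L : ℕ → List (Fin N)
  L i = fibre (U i)

  -- A walk r = x₀, x₁, …, x_k with x_i ∈ L i is stored as the vector x_k ∷ … ∷ x₀.
  mutual
    walks : (k : ℕ) → Fin N → List (Vec (Fin N) (suc k))
    walks zero    x = if does (x Fin.≟ r) then (x ∷ []) ∷ [] else []
    walks (suc k) x = if does (part x Fin.≟ U (suc k)) then concatMap (extend k x) (L k) else []

    extend : ∀ k → Fin N → Fin N → List (Vec (Fin N) (suc (suc k)))
    extend k x y = if adj y x then [] else map (x ∷_) (walks k y)

  #walks : ℕ → Fin N → ℕ
  #walks k x = length (walks k x)

  nonadjacent? : ∀ x y → Dec (adj y x ≡ false)
  nonadjacent? x y = adj y x ≟ᵇ false

  nonNeighbours : ℕ → Fin N → List (Fin N)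
  nonNeighbours k x = filter (nonadjacent? x) (L k)

  #walks-zero : ∀ x → #walks 0 x ≡ (if does (x Fin.≟ r) then 1 else 0)
  #walks-zero x with x Fin.≟ r
  ... | yes _ = refl
  ... | no  _ = refl

  #walks-suc : ∀ k x → part x ≡ U (suc k) → #walks (suc k) x ≡ ∑ (nonNeighbours k x) (#walks k)
  #walks-suc k x x∈ with part x Fin.≟ U (suc k)
  ... | no x∉ = contradiction x∈ x∉
  ... | yes _ = begin
    length (concatMap (extend k x) (L k))                                  ≡⟨ length-concatMap (extend k x) (L k) ⟩
    ∑ (L k) (length ∘ extend k x)                                          ≡⟨ ∑-cong (L k) (λ {y} _ → extension y) ⟩
    ∑ (L k) (λ y → if does (nonadjacent? x y) then #walks k y else 0)      ≡⟨ ∑-filter (nonadjacent? x) (L k) (#walks k) ⟩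
    ∑ (nonNeighbours k x) (#walks k)                                       ∎
    where
    open ≡-Reasoning
    extension : ∀ y → length (extend k x y) ≡ (if does (nonadjacent? x y) then #walks k y else 0)
    extension y with adj y x
    ... | true  = refl
    ... | false = length-map (x ∷_) (walks k y)

  data IsWalk : (k : ℕ) → Vec (Fin N) (suc k) → Set where
    start : IsWalk 0 (r ∷ [])
    step  : ∀ {k x y} {ys : Vec (Fin N) k} → IsWalk k (y ∷ ys) → part x ≡ U (suc k) → adj y x ≡ false →
            IsWalk (suc k) (x ∷ y ∷ ys)

  IsWalk-head : ∀ {k w} → IsWalk k w → part (head w) ≡ U k
  IsWalk-head start        = refl
  IsWalk-head (step _ x∈ _) = x∈

  step′ : ∀ {k x} {w : Vec (Fin N) (suc k)} → IsWalk k w → part x ≡ U (suc k) → adj (head w) x ≡ false → IsWalk (suc k) (x ∷ w)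
  step′ {w = _ ∷ _} = step

  ∈-extend⁻ : ∀ {k x y z} → z ∈ extend k x y → adj y x ≡ false × ∃ λ w → w ∈ walks k y × z ≡ x ∷ w
  ∈-extend⁻ {k} {x} {y} z∈ with adj y x
  ... | false with ∈-map⁻ (x ∷_) z∈
  ...   | w , w∈ , z≡ = refl , w , w∈ , z≡

  ∈-walks-suc⁻ : ∀ {k x z} → z ∈ walks (suc k) x → part x ≡ U (suc k) × ∃ λ y → y ∈ L k × z ∈ extend k x y
  ∈-walks-suc⁻ {k} {x} z∈ with part x Fin.≟ U (suc k)
  ... | yes x∈ = x∈ , find (∈-concatMap⁻ (extend k x) {L k} z∈)

  ∈-walks⁻ : ∀ k x {w} → w ∈ walks k x → IsWalk k w × head w ≡ x
  ∈-walks⁻ zero x w∈ with x Fin.≟ r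
  ∈-walks⁻ zero x (here refl) | yes refl = start , refl
  ∈-walks⁻ (suc k) x w∈ with ∈-walks-suc⁻ {k} w∈
  ... | x∈ , y , _ , w∈′ with ∈-extend⁻ {k} w∈′
  ...   | y≁x , (y′ ∷ ys) , ys∈ , refl with ∈-walks⁻ k y ys∈
  ...     | isWalk , refl = step isWalk x∈ y≁x , refl

  ∈-walks⁺ : ∀ {k w} → IsWalk k w → w ∈ walks k (head w)
  ∈-walks⁺ start with r Fin.≟ r
  ... | yes _   = here refl
  ... | no r≢r = contradiction refl r≢r
  ∈-walks⁺ (step {k} {x} {y} {ys} isWalk x∈ y≁x) with part x Fin.≟ U (suc k)
  ... | no x∉ = contradiction x∈ x∉
  ... | yes _ = ∈-concatMap⁺ (extend k x) (lose (∈-fibre⁺ (IsWalk-head isWalk)) extended)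
    where
    extended : (x ∷ y ∷ ys) ∈ extend k x y
    extended rewrite y≁x = ∈-map⁺ (x ∷_) (∈-walks⁺ isWalk)

  Unique-walks : ∀ k x → Unique (walks k x)
  Unique-walks zero x with x Fin.≟ r
  ... | yes _ = [] ∷ []
  ... | no  _ = []
  Unique-walks (suc k) x with part x Fin.≟ U (suc k)
  ... | no  _ = []
  ... | yes _ = Unique-concatMap⁺ (extend k x) (Unique-fibre (U k)) extensions! disjoint
    where
    extensions! : ∀ {y} → y ∈ L k → Unique (extend k x y)
    extensions! {y} _ with adj y x
    ... | true  = []
    ... | false = Unique.map⁺ Vec.∷-injectiveʳ (Unique-walks k y)
    disjoint : ∀ {y y′ z} → y ∈ L k → y′ ∈ L k → z ∈ extend k x y → z ∈ extend k x y′ → y ≡ y′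
    disjoint _ _ z∈ z∈′ with ∈-extend⁻ {k} z∈ | ∈-extend⁻ {k} z∈′
    ... | _ , w , w∈ , refl | _ , w′ , w∈′ , eq with Vec.∷-injectiveʳ eq
    ... | refl = trans (sym (proj₂ (∈-walks⁻ k _ w∈))) (proj₂ (∈-walks⁻ k _ w∈′))

  walk-parts : ∀ {k w a} → IsWalk k w → a ∈ toList w → ∃ λ i → i ≤ k × part a ≡ U i
  walk-parts start                (here refl) = 0 , z≤n , refl
  walk-parts (step {k} _ x∈ _)    (here refl) = suc k , ≤-refl , x∈
  walk-parts (step isWalk _ _)    (there a∈)  with walk-parts isWalk a∈
  ... | i , i≤k , a∈i = i , m≤n⇒m≤1+n i≤k , a∈i

  r∈walk : ∀ {k w} → IsWalk k w → r ∈ toList w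
  r∈walk start              = here refl
  r∈walk (step isWalk _ _) = there (r∈walk isWalk)

  head∈walk : ∀ {k w} → IsWalk k w → head w ∈ toList w
  head∈walk start        = here refl
  head∈walk (step _ _ _) = here refl

  U-fresh : ∀ {k i} → suc k < l → i ≤ k → U (suc k) ≢ U i
  U-fresh {k} {i} k<l i≤k eq = <⇒≢ (s≤s i≤k) (sym (rotate-injective (part r) k<l (≤-trans (s≤s i≤k) (<⇒≤ k<l)) eq))

  walk-injective-on-parts : ∀ {k w a b} → IsWalk k w → k < l → a ∈ toList w → b ∈ toList w → part a ≡ part b → a ≡ b
  walk-injective-on-parts start             _   (here refl) (here refl) _ = refl
  walk-injective-on-parts (step _ _ _)      _   (here refl) (here refl) _ = refl
  walk-injective-on-parts (step isWalk x∈ _) k<l (here refl) (there b∈) same with walk-parts isWalk b∈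
  ... | i , i≤k , b∈i = contradiction (trans (sym x∈) (trans same b∈i)) (U-fresh k<l i≤k)
  walk-injective-on-parts (step isWalk x∈ _) k<l (there a∈) (here refl) same with walk-parts isWalk a∈
  ... | i , i≤k , a∈i = contradiction (trans (sym x∈) (trans (sym same) a∈i)) (U-fresh k<l i≤k)
  walk-injective-on-parts (step isWalk _ _) k<l (there a∈) (there b∈) same =
    walk-injective-on-parts isWalk (<-trans (n<1+n _) k<l) a∈ b∈ same

  walk-head-unique : ∀ {k w a} → IsWalk k w → k < l → a ∈ toList w → part a ≡ U k → a ≡ head w
  walk-head-unique isWalk k<l a∈ a∈k =
    walk-injective-on-parts isWalk k<l a∈ (head∈walk isWalk) (trans a∈k (sym (IsWalk-head isWalk)))

  Unique-walk : ∀ {k w} → IsWalk k w → k < l → Unique (toList w)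
  Unique-walk start               _   = [] ∷ []
  Unique-walk (step isWalk x∈ _) k<l =
    All.tabulate (λ z∈ x≡z → let (i , i≤k , z∈i) = walk-parts isWalk z∈ in
                              U-fresh k<l i≤k (trans (sym x∈) (trans (cong part x≡z) z∈i)))
    ∷ Unique-walk isWalk (<-trans (n<1+n _) k<l)

  walk-nonadjacent-forward : ∀ {k w a b} → 1 ≤ K → IsWalk k w → k < l → a ∈ toList w → b ∈ toList w →
    part b ≡ next (part a) → part b ≢ part r → adj a b ≡ false
  walk-nonadjacent-forward 1≤K start _ (here refl) (here refl) b∈next _ = contradiction (sym b∈next) (next-≢ 1≤K (part r))
  walk-nonadjacent-forward 1≤K (step _ _ _) _ (here refl) (here refl) b∈next _ = contradiction (sym b∈next) (next-≢ 1≤K _)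
  walk-nonadjacent-forward {suc k} 1≤K (step isWalk x∈ _) k<l (here refl) (there b∈) b∈next b∉r with walk-parts isWalk b∈
  ... | i , i≤k , b∈i with suc (suc k) <? l
  ...   | yes k+1<l = contradiction (trans (sym (cong next x∈)) (trans (sym b∈next) b∈i)) (U-fresh k+1<l (m≤n⇒m≤1+n i≤k))
  ...   | no  k+1≮l = contradiction (trans b∈next (trans (cong next x∈) (trans (cong U k+2≡l) (rotate-l (part r))))) b∉r
    where
    k+2≡l : suc (suc k) ≡ l
    k+2≡l = ≤-antisym k<l (≮⇒≥ k+1≮l)
  walk-nonadjacent-forward {suc k} {_} {a} 1≤K (step {k} {x} {y} isWalk x∈ y≁x) k<l (there a∈) (here refl) x∈next _
    with walk-parts isWalk a∈
  ... | i , i≤k , a∈i = subst (λ z → adj z x ≡ false) (sym a≡y) y≁x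
    where
    k≡i : suc k ≡ suc i
    k≡i = rotate-injective (part r) k<l (≤-trans (s≤s (s≤s i≤k)) k<l) (trans (sym x∈) (trans x∈next (cong next a∈i)))
    a≡y : a ≡ y
    a≡y = walk-head-unique isWalk (<-trans (n<1+n _) k<l) a∈ (trans a∈i (cong U (sym (suc-injective k≡i))))
  walk-nonadjacent-forward 1≤K (step isWalk _ _) k<l (there a∈) (there b∈) b∈next b∉r =
    walk-nonadjacent-forward 1≤K isWalk (<-trans (n<1+n _) k<l) a∈ b∈ b∈next b∉r

  module _ (1≤K : 1 ≤ K) {w : Vec (Fin N) (suc K)} (isWalk : IsWalk K w) (closing : adj (head w) r ≡ false) where

    closedWalk-nonadjacent-forward : ∀ {a b} → a ∈ toList w → b ∈ toList w → next (part a) ≡ part b → adj a b ≡ false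
    closedWalk-nonadjacent-forward {a} {b} a∈ b∈ forward with part b Fin.≟ part r
    ... | no  b∉v = walk-nonadjacent-forward 1≤K isWalk (n<1+n K) a∈ b∈ (sym forward) b∉v
    ... | yes b∈v = subst₂ (λ a b → adj a b ≡ false) (sym a≡head) (sym b≡r) closing
      where
      b≡r : b ≡ r
      b≡r = walk-injective-on-parts isWalk (n<1+n K) b∈ (r∈walk isWalk) b∈v
      a≡head : a ≡ head w
      a≡head = walk-head-unique isWalk (n<1+n K) a∈ (next-injective (trans forward (trans b∈v (sym (rotate-l (part r))))))

    closedWalk-independent : ∀ {a b} → a ∈ toList w → b ∈ toList w → adj a b ≡ false
    closedWalk-independent {a} {b} a∈ b∈ with adj a b in a~b
    ... | false = refl
    ... | true with a Fin.≟ b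
    ...   | yes refl = trans (sym a~b) (irrefl a)
    ...   | no a≢b with part a Fin.≟ part b
    ...     | yes same = contradiction (walk-injective-on-parts isWalk (n<1+n K) a∈ b∈ same) a≢b
    ...     | no apart with cycleAdj⇒next (onEdges a b apart a~b)
    ...       | inj₁ forward  = trans (sym a~b) (closedWalk-nonadjacent-forward a∈ b∈ forward)
    ...       | inj₂ backward = trans (sym a~b) (trans (adj-sym a b) (closedWalk-nonadjacent-forward b∈ a∈ backward))

  walk-⊆⇒≡ : ∀ {k w w′} → IsWalk k w → IsWalk k w′ → k < l → toList w ⊆ toList w′ → w ≡ w′
  walk-⊆⇒≡ start start _ _ = refl
  walk-⊆⇒≡ {w = w} {w′} (step isWalk x∈ _) (step isWalk′ x′∈ y′≁x′) k<l w⊆w′ =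
    cong₂ _∷_ (walk-head-unique (step isWalk′ x′∈ y′≁x′) k<l (w⊆w′ (here refl)) x∈)
              (walk-⊆⇒≡ isWalk isWalk′ (<-trans (n<1+n _) k<l) tail⊆)
    where
    tail⊆ : toList (Data.Vec.tail w) ⊆ toList (Data.Vec.tail w′)
    tail⊆ a∈ with w⊆w′ (there a∈)
    ... | there a∈′ = a∈′
    ... | here refl with walk-parts isWalk a∈
    ...   | i , i≤k , a∈i = contradiction (trans (sym x′∈) a∈i) (U-fresh k<l i≤k)

  closedWalks : List (Vec (Fin N) (suc (suc K)))
  closedWalks = walks (suc K) r

  #closedWalks : ℕ
  #closedWalks = #walks (suc K) r

  record ClosedWalk (z : Vec (Fin N) (suc (suc K))) : Set where
    field
      {body}  : Vec (Fin N) (suc K)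
      shape   : z ≡ r ∷ body
      isWalk  : IsWalk K body
      closing : adj (head body) r ≡ false

  ∈-closedWalks⁻ : ∀ {z} → z ∈ closedWalks → ClosedWalk z
  ∈-closedWalks⁻ z∈ with ∈-walks⁻ (suc K) r z∈
  ... | step isWalk _ closing , refl = record { shape = refl ; isWalk = isWalk ; closing = closing }

  vertexSet : Vec (Fin N) (suc (suc K)) → Subset N
  vertexSet z = setOf (toList (Data.Vec.tail z))

  vertexSet-coloring : 1 ≤ K → ∀ {z} → z ∈ closedWalks → vertexSet z ∈ coloringsThrough r
  vertexSet-coloring 1≤K z∈ with ∈-closedWalks⁻ z∈
  ... | record { body = body ; shape = refl ; isWalk = isWalk ; closing = closing } =
    ∈-coloringsThrough⁺
      (independentᵇ-complete adj (setOf (toList body)) λ a∈ b∈ → closedWalk-independent 1≤K isWalk closing (memᵇ-setOf⁻ a∈) (memᵇ-setOf⁻ b∈))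
      (trans (∣setOf∣ (Unique-walk isWalk (n<1+n K))) (Vec.length-toList body))
      (memᵇ-setOf⁺ (r∈walk isWalk))

  vertexSet-injective : ∀ {z z′} → z ∈ closedWalks → z′ ∈ closedWalks → vertexSet z ≡ vertexSet z′ → z ≡ z′
  vertexSet-injective z∈ z′∈ same with ∈-closedWalks⁻ z∈ | ∈-closedWalks⁻ z′∈
  ... | record { shape = refl ; isWalk = isWalk } | record { shape = refl ; isWalk = isWalk′ } =
    cong (r ∷_) (walk-⊆⇒≡ isWalk isWalk′ (n<1+n K) λ a∈ → memᵇ-setOf⁻ (subst (λ s → memᵇ _ s ≡ true) same (memᵇ-setOf⁺ a∈)))

  #closedWalks≤Nr : 1 ≤ K → #closedWalks ≤ Nr 𝓗 r
  #closedWalks≤Nr 1≤K = injective-on⇒length≤ (Vec.≡-dec Fin._≟_) (Vec.≡-dec _≟ᵇ_) vertexSet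
    (Unique-walks (suc K) r) (vertexSet-coloring 1≤K) vertexSet-injective

  -- The default r is never returned on a coloring, which meets every part.
  pickFrom : Subset N → ℕ → List (Fin N) → Fin N
  pickFrom c i []       = r
  pickFrom c i (x ∷ xs) = if memᵇ x c ∧ does (part x Fin.≟ U i) then x else pickFrom c i xs

  pick : Subset N → ℕ → Fin N
  pick c i = pickFrom c i (allFin N)

  pick-unique : ∀ {c i x} → memᵇ x c ≡ true → part x ≡ U i →
    (∀ {y} → memᵇ y c ≡ true → part y ≡ U i → y ≡ x) → pick c i ≡ x
  pick-unique {c} {i} {x} x∈c x∈i unique = search-finds (allFin N) (∈-allFin x)
    where
    search-finds : ∀ xs → x ∈ xs → pickFrom c i xs ≡ x
    search-finds (y ∷ xs) x∈ with memᵇ y c in y∈c | part y Fin.≟ U i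
    ... | true  | yes y∈i = unique y∈c y∈i
    ... | true  | no  y∉i = search-finds xs (later x∈)
      where
      later : x ∈ y ∷ xs → x ∈ xs
      later (here refl) = contradiction x∈i y∉i
      later (there x∈)  = x∈
    ... | false | _       = search-finds xs (later x∈)
      where
      later : x ∈ y ∷ xs → x ∈ xs
      later (here refl) = contradiction (trans (sym y∈c) x∈c) λ ()
      later (there x∈)  = x∈

  mutual
    trace : (k : ℕ) → Subset N → Vec (Fin N) (suc k)
    trace k c = pick c k ∷ traceBefore k c

    traceBefore : (k : ℕ) → Subset N → Vec (Fin N) k
    traceBefore zero    c = []
    traceBefore (suc k) c = trace k c

  module _ {c : Subset N} (col : IsColoringThrough r c) where
    open IsColoringThrough col

    pick-in-part : ∀ {i x} → memᵇ x c ≡ true → part x ≡ U i → pick c i ≡ x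
    pick-in-part x∈c x∈i = pick-unique x∈c x∈i λ y∈c y∈i → coloring-injective-on-parts c independent y∈c x∈c (trans y∈i (sym x∈i))

    pick-spec : ∀ i → memᵇ (pick c i) c ≡ true × part (pick c i) ≡ U i
    pick-spec i with coloring-meets-part c independent size (U i)
    ... | x , x∈c , x∈i = subst (λ y → memᵇ y c ≡ true × part y ≡ U i) (sym (pick-in-part x∈c x∈i)) (x∈c , x∈i)

    trace-isWalk : ∀ k → IsWalk k (trace k c)
    trace-isWalk zero    rewrite pick-in-part {0} through refl = start
    trace-isWalk (suc k) = step′ (trace-isWalk k) (proj₂ (pick-spec (suc k)))
      (independentᵇ-sound adj c independent (proj₁ (pick-spec k)) (proj₁ (pick-spec (suc k))))

    trace-closed : r ∷ trace K c ∈ closedWalks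
    trace-closed = ∈-walks⁺ (step′ (trace-isWalk K) (sym (rotate-l (part r)))
      (independentᵇ-sound adj c independent (proj₁ (pick-spec K)) through))

    ∈-trace⁻ : ∀ k {x} → x ∈ toList (trace k c) → memᵇ x c ≡ true
    ∈-trace⁻ k       (here refl) = proj₁ (pick-spec k)
    ∈-trace⁻ (suc k) (there x∈)  = ∈-trace⁻ k x∈

    pick∈trace : ∀ {i k} → i ≤ k → pick c i ∈ toList (trace k c)
    pick∈trace {i} {k} i≤k with m≤n⇒m<n∨m≡n i≤k
    ... | inj₂ refl = here refl
    ... | inj₁ (s≤s i≤k-1) = there (pick∈trace i≤k-1)

    ∈-trace⁺ : ∀ {x} → memᵇ x c ≡ true → x ∈ toList (trace K c)
    ∈-trace⁺ {x} x∈c with rotate-surjective (part r) (part x)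
    ... | i , i<l , x∈i = subst (λ y → y ∈ toList (trace K c)) (pick-in-part x∈c (sym x∈i)) (pick∈trace (≤-pred i<l))

  closingTrace : Subset N → Vec (Fin N) (suc (suc K))
  closingTrace c = r ∷ trace K c

  closingTrace-injective : ∀ {c c′} → c ∈ coloringsThrough r → c′ ∈ coloringsThrough r → closingTrace c ≡ closingTrace c′ → c ≡ c′
  closingTrace-injective {c} {c′} c∈ c′∈ same = memᵇ-ext members
    where
    col  = ∈-coloringsThrough⁻ c∈
    col′ = ∈-coloringsThrough⁻ c′∈
    traces : trace K c ≡ trace K c′
    traces = Vec.∷-injectiveʳ same
    members : ∀ x → memᵇ x c ≡ memᵇ x c′
    members x with memᵇ x c in x∈c | memᵇ x c′ in x∈c′
    ... | true  | true  = refl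
    ... | false | false = refl
    ... | true  | false = trans (sym (∈-trace⁻ col′ K (subst (λ t → x ∈ toList t) traces (∈-trace⁺ col x∈c)))) x∈c′
    ... | false | true  = trans (sym x∈c) (∈-trace⁻ col K (subst (λ t → x ∈ toList t) (sym traces) (∈-trace⁺ col′ x∈c′)))

  Nr≤#closedWalks : Nr 𝓗 r ≤ #closedWalks
  Nr≤#closedWalks = injective-on⇒length≤ (Vec.≡-dec _≟ᵇ_) (Vec.≡-dec Fin._≟_) closingTrace
    (Unique-coloringsThrough r) (trace-closed ∘ ∈-coloringsThrough⁻) closingTrace-injective

  Nr≡#closedWalks : 1 ≤ K → Nr 𝓗 r ≡ #closedWalks
  Nr≡#closedWalks 1≤K = ≤-antisym Nr≤#closedWalks (#closedWalks≤Nr 1≤K)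

  module _ (1≤K : 1 ≤ K) where

    neighbour-below-unique : ∀ k {x y z} → part x ≡ U (suc k) → y ∈ L k → z ∈ L k → adj y x ≡ true → adj z x ≡ true → y ≡ z
    neighbour-below-unique k {x} x∈ y∈ z∈ y~x z~x =
      matching x _ _ (λ same → next-≢ 1≤K (U k) (trans (sym x∈) (trans same (∈-fibre⁻ y∈))))
        (trans (∈-fibre⁻ y∈) (sym (∈-fibre⁻ z∈))) (trans (adj-sym x _) y~x) (trans (adj-sym x _) z~x)

    neighbour-above-unique : ∀ k {x y z} → part x ≡ U k → y ∈ L (suc k) → z ∈ L (suc k) → adj x y ≡ true → adj x z ≡ true → y ≡ z
    neighbour-above-unique k {x} x∈ y∈ z∈ =
      matching x _ _ (λ same → next-≢ 1≤K (U k) (trans (sym (∈-fibre⁻ y∈)) (trans (sym same) x∈)))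
        (trans (∈-fibre⁻ y∈) (sym (∈-fibre⁻ z∈)))

    ∈-nonNeighbours⁺ : ∀ k {x y} → y ∈ L k → adj y x ≡ false → y ∈ nonNeighbours k x
    ∈-nonNeighbours⁺ k {x} = ∈-filter⁺ (nonadjacent? x)

    ∈-nonNeighbours⁻ : ∀ k {x y} → y ∈ nonNeighbours k x → y ∈ L k × adj y x ≡ false
    ∈-nonNeighbours⁻ k {x} = ∈-filter⁻ (nonadjacent? x) {xs = L k}

    Unique-nonNeighbours : ∀ k x → Unique (nonNeighbours k x)
    Unique-nonNeighbours k x = Unique.filter⁺ (nonadjacent? x) (Unique-fibre (U k))

    length-nonNeighbours : ∀ k {x} → part x ≡ U (suc k) → m ∸ 1 ≤ length (nonNeighbours k x)
    length-nonNeighbours k {x} x∈ = begin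
      m ∸ 1                                               ≡⟨ cong (_∸ 1) (trans (sym (foldSize (U k))) (sym (length-partition (nonadjacent? x) (L k)))) ⟩
      length (nonNeighbours k x) + length neighbours ∸ 1   ≤⟨ ∸-monoˡ-≤ 1 (+-monoʳ-≤ (length (nonNeighbours k x)) atMostOne) ⟩
      length (nonNeighbours k x) + 1 ∸ 1                   ≡⟨ m+n∸n≡m _ 1 ⟩
      length (nonNeighbours k x)                           ∎
      where
      open ≤-Reasoning
      neighbours = filter (¬? ∘ nonadjacent? x) (L k)
      atMostOne : length neighbours ≤ 1
      atMostOne = Unique-allEqual⇒length≤1 (Unique.filter⁺ (¬? ∘ nonadjacent? x) (Unique-fibre (U k))) λ y∈ z∈ →
        let (y∈k , y~x) = ∈-filter⁻ (¬? ∘ nonadjacent? x) {xs = L k} y∈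
            (z∈k , z~x) = ∈-filter⁻ (¬? ∘ nonadjacent? x) {xs = L k} z∈
        in neighbour-below-unique k x∈ y∈k z∈k (¬-not y~x) (¬-not z~x)

    record LevelBound (k : ℕ) : Set where
      field
        special       : Fin N
        special∈      : part special ≡ U k
        special-bound : walksSame m k ≤ #walks k special
        other-bound   : ∀ {x} → part x ≡ U k → x ≢ special → walksOther m k ≤ #walks k x

    level-bound-zero : LevelBound 0
    level-bound-zero = record
      { special = r ; special∈ = refl ; special-bound = one ; other-bound = λ _ _ → z≤n }
      where
      one : 1 ≤ #walks 0 r
      one rewrite #walks-zero r with r Fin.≟ r
      ... | yes _  = ≤-refl
      ... | no r≢r = contradiction refl r≢r

    module LevelStep {k : ℕ} (bound : LevelBound k) where
      open LevelBound bound

      nonNeighbours-bound : ∀ {x} → part x ≡ U (suc k) → ∀ {y} → y ∈ nonNeighbours k x → y ≢ special → walksOther m k ≤ #walks k y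
      nonNeighbours-bound _ y∈ = other-bound (∈-fibre⁻ (proj₁ (∈-nonNeighbours⁻ k y∈)))

      same-bound : ∀ {x} → part x ≡ U (suc k) → m ∸ 1 ≤ length (remove Fin._≟_ special (nonNeighbours k x)) →
        walksSame m (suc k) ≤ #walks (suc k) x
      same-bound {x} x∈ enough = begin
        (m ∸ 1) * walksOther m k                                          ≤⟨ *-monoˡ-≤ (walksOther m k) enough ⟩
        length (remove Fin._≟_ special (nonNeighbours k x)) * walksOther m k ≤⟨ ∑-≥-others Fin._≟_ (nonNeighbours k x) special (#walks k) (nonNeighbours-bound x∈) ⟩
        ∑ (nonNeighbours k x) (#walks k)                                  ≡⟨ #walks-suc k x x∈ ⟨
        #walks (suc k) x                                                  ∎
        where open ≤-Reasoning

      other-bound-suc : ∀ {x} → part x ≡ U (suc k) → adj special x ≡ false → walksOther m (suc k) ≤ #walks (suc k) x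
      other-bound-suc {x} x∈ special≁x = begin
        walksSame m k + (m ∸ 2) * walksOther m k                                          ≤⟨ +-monoʳ-≤ (walksSame m k) (*-monoˡ-≤ (walksOther m k) enough) ⟩
        walksSame m k + length (remove Fin._≟_ special (nonNeighbours k x)) * walksOther m k ≤⟨ ∑-≥-special+others Fin._≟_ (nonNeighbours k x) special (#walks k) special∈NN special-bound (nonNeighbours-bound x∈) ⟩
        ∑ (nonNeighbours k x) (#walks k)                                                  ≡⟨ #walks-suc k x x∈ ⟨
        #walks (suc k) x                                                                  ∎
        where
        open ≤-Reasoning
        special∈NN : special ∈ nonNeighbours k x
        special∈NN = ∈-nonNeighbours⁺ k (∈-fibre⁺ special∈) special≁x
        enough : m ∸ 2 ≤ length (remove Fin._≟_ special (nonNeighbours k x))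
        enough = begin
          m ∸ 2                                                   ≡⟨ ∸-+-assoc m 1 1 ⟨
          m ∸ 1 ∸ 1                                               ≤⟨ ∸-monoˡ-≤ 1 (length-nonNeighbours k x∈) ⟩
          length (nonNeighbours k x) ∸ 1                          ≡⟨ cong (_∸ 1) (length-remove-∈ Fin._≟_ _ (Unique-nonNeighbours k x) special∈NN) ⟨
          suc (length (remove Fin._≟_ special (nonNeighbours k x))) ∸ 1 ≡⟨⟩
          length (remove Fin._≟_ special (nonNeighbours k x))     ∎

      private
        neighbourBelow : Fin N → Fin N
        neighbourBelow x with any? (λ y → adj y x ≟ᵇ true) (L k)
        ... | yes y~x = proj₁ (find y~x)
        ... | no  _   = special

        neighbourBelow-spec : ∀ {x} → ¬ All (λ y → adj y x ≡ false) (L k) → neighbourBelow x ∈ L k × adj (neighbourBelow x) x ≡ true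
        neighbourBelow-spec {x} notIsolated with any? (λ y → adj y x ≟ᵇ true) (L k)
        ... | yes y~x = proj₂ (find y~x)
        ... | no none = contradiction (All.map ¬-not (¬Any⇒All¬ (L k) none)) notIsolated

      isolated-exists : (∀ {x} → x ∈ L (suc k) → adj special x ≡ false) → ∃ λ x → x ∈ L (suc k) × All (λ y → adj y x ≡ false) (L k)
      isolated-exists special-isolated with any? (λ x → All.all? (λ y → adj y x ≟ᵇ false) (L k)) (L (suc k))
      ... | yes some = find some
      ... | no none = contradiction pigeonhole (<⇒≱ (begin-strict
            length (remove Fin._≟_ special (L k)) <⟨ length-remove-< Fin._≟_ (L k) (∈-fibre⁺ special∈) ⟩
            length (L k)                         ≡⟨ foldSize (U k) ⟩
            m                                    ≡⟨ foldSize (U (suc k)) ⟨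
            length (L (suc k))                   ∎))
        where
        open ≤-Reasoning
        notIsolated : ∀ {x} → x ∈ L (suc k) → ¬ All (λ y → adj y x ≡ false) (L k)
        notIsolated = All.lookup (¬Any⇒All¬ (L (suc k)) none)
        pigeonhole : length (L (suc k)) ≤ length (remove Fin._≟_ special (L k))
        pigeonhole = injective-on⇒length≤ Fin._≟_ Fin._≟_ neighbourBelow (Unique-fibre (U (suc k)))
          (λ x∈ → let (y∈ , y~x) = neighbourBelow-spec (notIsolated x∈) in
                  ∈-remove⁺ Fin._≟_ y∈ λ y≡special → contradiction (trans (sym y~x) (subst (λ y → adj y _ ≡ false) (sym y≡special) (special-isolated x∈))) λ ())
          (λ x∈ x′∈ same → let (y∈ , y~x) = neighbourBelow-spec (notIsolated x∈)
                               (_ , y~x′) = neighbourBelow-spec (notIsolated x′∈)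
                           in neighbour-above-unique k (∈-fibre⁻ y∈) x∈ x′∈ y~x (subst (λ y → adj y _ ≡ true) (sym same) y~x′))

      -- If the special vertex has a neighbour in the next part, that neighbour becomes special;
      -- otherwise some vertex of the next part has no neighbour at all in this part.
      level-bound-suc : LevelBound (suc k)
      level-bound-suc with any? (λ x → adj special x ≟ᵇ true) (L (suc k))
      ... | yes hasNeighbour = let (x′ , x′∈ , special~x′) = find hasNeighbour in record
        { special       = x′
        ; special∈      = ∈-fibre⁻ x′∈
        ; special-bound = same-bound (∈-fibre⁻ x′∈) (≤-trans (length-nonNeighbours k (∈-fibre⁻ x′∈))
                            (≤-reflexive (sym (length-remove-∉ Fin._≟_ _ λ special∈NN →
                              contradiction (trans (sym special~x′) (proj₂ (∈-nonNeighbours⁻ k special∈NN))) λ ()))))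
        ; other-bound   = λ {x} x∈ x≢x′ → other-bound-suc x∈ (¬-not λ special~x →
                            x≢x′ (neighbour-above-unique k special∈ (∈-fibre⁺ x∈) x′∈ special~x special~x′))
        }
      ... | no noNeighbour with isolated-exists (λ x∈ → ¬-not (All.lookup (¬Any⇒All¬ (L (suc k)) noNeighbour) x∈))
      ...   | x′ , x′∈ , isolated = record
        { special       = x′
        ; special∈      = ∈-fibre⁻ x′∈
        ; special-bound = same-bound (∈-fibre⁻ x′∈) (≤-reflexive (begin
            m ∸ 1                                                 ≡⟨ cong (_∸ 1) (trans (sym (foldSize (U k))) (sym (length-remove-∈ Fin._≟_ (L k) (Unique-fibre (U k)) (∈-fibre⁺ special∈)))) ⟩
            length (remove Fin._≟_ special (L k))                 ≡⟨ cong (length ∘ remove Fin._≟_ special) (filter-all (nonadjacent? x′) isolated) ⟨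
            length (remove Fin._≟_ special (nonNeighbours k x′))  ∎))
        ; other-bound   = λ x∈ _ → other-bound-suc x∈ (¬-not (All.lookup (¬Any⇒All¬ (L (suc k)) noNeighbour) (∈-fibre⁺ x∈)))
        }
        where open ≡-Reasoning

    level-bound : ∀ k → LevelBound k
    level-bound zero    = level-bound-zero
    level-bound (suc k) = LevelStep.level-bound-suc (level-bound k)

    walksSame⊓walksOther≤#closedWalks : walksSame m (suc K) ⊓ walksOther m (suc K) ≤ #closedWalks
    walksSame⊓walksOther≤#closedWalks with level-bound (suc K)
    ... | record { special = special ; special-bound = special-bound ; other-bound = other-bound } with r Fin.≟ special
    ...   | yes refl  = ≤-trans (m⊓n≤m _ _) special-bound
    ...   | no  r≢sp = ≤-trans (m⊓n≤n _ _) (other-bound (sym (rotate-l (part r))) r≢sp)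

    module _ {k t a b} (t-bounded : #walks k t ≤ a) (others-bounded : ∀ {y} → y ∈ L k → y ≢ t → #walks k y ≤ b)
             {x n} (x∈ : part x ≡ U (suc k)) (n∈ : n ∈ L k) (n~x : adj n x ≡ true) where

      private
        nonNeighbours⊆ : nonNeighbours k x ⊆ remove Fin._≟_ n (L k)
        nonNeighbours⊆ y∈ = let (y∈k , y≁x) = ∈-nonNeighbours⁻ k y∈ in
          ∈-remove⁺ Fin._≟_ y∈k λ { refl → contradiction (trans (sym n~x) y≁x) λ () }

        length-nonNeighbours≤ : length (nonNeighbours k x) ≤ m ∸ 1
        length-nonNeighbours≤ = begin
          length (nonNeighbours k x)              ≤⟨ Unique-⊆⇒length≤ Fin._≟_ (Unique-nonNeighbours k x) nonNeighbours⊆ ⟩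
          length (remove Fin._≟_ n (L k))         ≡⟨ m+n∸n≡m _ 1 ⟨
          length (remove Fin._≟_ n (L k)) + 1 ∸ 1 ≡⟨ cong (_∸ 1) (trans (+-comm _ 1) (trans (length-remove-∈ Fin._≟_ (L k) (Unique-fibre (U k)) n∈) (foldSize (U k)))) ⟩
          m ∸ 1                                   ∎
          where open ≤-Reasoning

        other-bounded : ∀ {y} → y ∈ nonNeighbours k x → y ≢ t → #walks k y ≤ b
        other-bounded y∈ = others-bounded (proj₁ (∈-nonNeighbours⁻ k y∈))

      #walks≤-via : n ≡ t → #walks (suc k) x ≤ (m ∸ 1) * b
      #walks≤-via refl = begin
        #walks (suc k) x                  ≡⟨ #walks-suc k x x∈ ⟩
        ∑ (nonNeighbours k x) (#walks k)  ≤⟨ ∑-≤-const (nonNeighbours k x) (λ y∈ → other-bounded y∈ λ { refl → contradiction (trans (sym n~x) (proj₂ (∈-nonNeighbours⁻ k y∈))) λ () }) ⟩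
        length (nonNeighbours k x) * b    ≤⟨ *-monoˡ-≤ b length-nonNeighbours≤ ⟩
        (m ∸ 1) * b                       ∎
        where open ≤-Reasoning

      #walks≤-avoiding : t ∈ L k → n ≢ t → #walks (suc k) x ≤ a + (m ∸ 2) * b
      #walks≤-avoiding t∈ n≢t = begin
        #walks (suc k) x                                            ≡⟨ #walks-suc k x x∈ ⟩
        ∑ (nonNeighbours k x) (#walks k)                            ≤⟨ ∑-≤-special+others Fin._≟_ (nonNeighbours k x) t (#walks k) (Unique-nonNeighbours k x) (λ _ → t-bounded) other-bounded ⟩
        a + length (remove Fin._≟_ t (nonNeighbours k x)) * b       ≤⟨ +-monoʳ-≤ a (*-monoˡ-≤ b fewer) ⟩
        a + (m ∸ 2) * b                                             ∎
        where
        open ≤-Reasoning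
        t∈NN : t ∈ nonNeighbours k x
        t∈NN = ∈-nonNeighbours⁺ k t∈ (¬-not λ t~x → n≢t (neighbour-below-unique k x∈ n∈ t∈ n~x t~x))
        fewer : length (remove Fin._≟_ t (nonNeighbours k x)) ≤ m ∸ 2
        fewer = begin
          length (remove Fin._≟_ t (nonNeighbours k x))         ≡⟨⟩
          suc (length (remove Fin._≟_ t (nonNeighbours k x))) ∸ 1 ≡⟨ cong (_∸ 1) (length-remove-∈ Fin._≟_ _ (Unique-nonNeighbours k x) t∈NN) ⟩
          length (nonNeighbours k x) ∸ 1                        ≤⟨ ∸-monoˡ-≤ 1 length-nonNeighbours≤ ⟩
          m ∸ 1 ∸ 1                                             ≡⟨ ∸-+-assoc m 1 1 ⟩
          m ∸ 2                                                 ∎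

module TwistedCover (K M : ℕ) (2≤K : 2 ≤ K) (1≤M : 1 ≤ M) (v₀ : Fin (suc K)) (twisted : Bool) where
  open CycleArithmetic K
  private module Colour = CycleArithmetic M

  m : ℕ
  m = suc M

  N : ℕ
  N = l * m

  vertex : Fin l → Fin m → Fin N
  vertex = combine

  part : Fin N → Fin l
  part x = proj₁ (remQuot {l} m x)

  colour : Fin N → Fin m
  colour x = proj₂ (remQuot {l} m x)

  part-vertex : ∀ w c → part (vertex w c) ≡ w
  part-vertex w c = cong proj₁ (Fin.remQuot-combine {l} {m} w c)

  colour-vertex : ∀ w c → colour (vertex w c) ≡ c
  colour-vertex w c = cong proj₂ (Fin.remQuot-combine {l} {m} w c)

  vertex-part-colour : ∀ x → vertex (part x) (colour x) ≡ x
  vertex-part-colour = Fin.combine-remQuot {l} m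

  ≡-from-part-colour : ∀ {x y} → part x ≡ part y → colour x ≡ colour y → x ≡ y
  ≡-from-part-colour {x} {y} same-part same-colour =
    trans (sym (vertex-part-colour x)) (trans (cong₂ vertex same-part same-colour) (vertex-part-colour y))

  -- Colour c in part w is matched to colour σ w c in part next w.
  σ : Fin l → Fin m → Fin m
  σ w c = if does (next w Fin.≟ v₀) ∧ twisted then Colour.next c else c

  σ-injective : ∀ w {c c′} → σ w c ≡ σ w c′ → c ≡ c′
  σ-injective w eq with does (next w Fin.≟ v₀) ∧ twisted
  ... | true  = Colour.next-injective eq
  ... | false = eq

  adjacentWhen : ∀ {w w′} → Dec (w ≡ w′) → Dec (next w ≡ w′) → Dec (next w′ ≡ w) → Fin m → Fin m → Bool
  adjacentWhen         (yes _) _       _       c c′ = not (does (c Fin.≟ c′))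
  adjacentWhen {w}     (no _)  (yes _) _       c c′ = does (c′ Fin.≟ σ w c)
  adjacentWhen {w′ = w′} (no _) (no _) (yes _) c c′ = does (c Fin.≟ σ w′ c′)
  adjacentWhen         (no _)  (no _)  (no _)  c c′ = false

  adjacentᵛ : Fin l → Fin m → Fin l → Fin m → Bool
  adjacentᵛ w c w′ c′ = adjacentWhen (w Fin.≟ w′) (next w Fin.≟ w′) (next w′ Fin.≟ w) c c′

  adjacent : Fin N → Fin N → Bool
  adjacent x y = adjacentᵛ (part x) (colour x) (part y) (colour y)

  private
    does-≡ : ∀ {n} {a b : Fin n} → does (a Fin.≟ b) ≡ true → a ≡ b
    does-≡ {a = a} {b} eq with a Fin.≟ b
    ... | yes a≡b = a≡b

    does-sym : ∀ {n} (a b : Fin n) → does (a Fin.≟ b) ≡ does (b Fin.≟ a)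
    does-sym a b with a Fin.≟ b | b Fin.≟ a
    ... | yes _   | yes _   = refl
    ... | no  _   | no  _   = refl
    ... | yes a≡b | no  b≢a = contradiction (sym a≡b) b≢a
    ... | no  a≢b | yes b≡a = contradiction (sym b≡a) a≢b

  adjacentᵛ-sym : ∀ w c w′ c′ → adjacentᵛ w c w′ c′ ≡ adjacentᵛ w′ c′ w c
  adjacentᵛ-sym w c w′ c′ with w Fin.≟ w′ | next w Fin.≟ w′ | next w′ Fin.≟ w | w′ Fin.≟ w
  ... | yes _    | _        | _        | yes _    = cong not (does-sym c c′)
  ... | yes w≡w′ | _        | _        | no w′≢w  = contradiction (sym w≡w′) w′≢w
  ... | no w≢w′  | _        | _        | yes w′≡w = contradiction (sym w′≡w) w≢w′
  ... | no _     | yes fwd  | yes bwd  | no _     = contradiction (trans (cong next fwd) bwd) (next²-≢ 2≤K w)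
  ... | no _     | yes _    | no _     | no _     = refl
  ... | no _     | no _     | yes _    | no _     = refl
  ... | no _     | no _     | no _     | no _     = refl

  adjacentᵛ-irrefl : ∀ w c → adjacentᵛ w c w c ≡ false
  adjacentᵛ-irrefl w c with w Fin.≟ w
  ... | no w≢w = contradiction refl w≢w
  ... | yes _ with c Fin.≟ c
  ...   | yes _  = refl
  ...   | no c≢c = contradiction refl c≢c

  adjacentᵛ-matching : ∀ w c w′ c₁ c₂ → w ≢ w′ → adjacentᵛ w c w′ c₁ ≡ true → adjacentᵛ w c w′ c₂ ≡ true → c₁ ≡ c₂
  adjacentᵛ-matching w c w′ c₁ c₂ w≢w′ adj₁ adj₂ with w Fin.≟ w′ | next w Fin.≟ w′ | next w′ Fin.≟ w
  ... | yes w≡w′ | _     | _     = contradiction w≡w′ w≢w′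
  ... | no _     | yes _ | _     = trans (does-≡ adj₁) (sym (does-≡ adj₂))
  ... | no _     | no _  | yes _ = σ-injective w′ (trans (sym (does-≡ {a = c} adj₁)) (does-≡ {a = c} adj₂))

  fibre-size : ∀ u → length (filter (λ x → part x Fin.≟ u) (allFin N)) ≡ m
  fibre-size u = ≤-antisym
    (≤-trans (injective-on⇒length≤ Fin._≟_ Fin._≟_ colour (Unique.filter⁺ (λ x → part x Fin.≟ u) (Unique.allFin⁺ N))
               (λ {x} _ → ∈-allFin (colour x))
               (λ x∈ y∈ → ≡-from-part-colour (trans (in-u x∈) (sym (in-u y∈)))))
             (≤-reflexive (length-tabulate (λ c → c))))
    (≤-trans (≤-reflexive (sym (length-tabulate (λ c → c))))
             (injective-on⇒length≤ Fin._≟_ Fin._≟_ (vertex u) (Unique.allFin⁺ m)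
               (λ {c} _ → ∈-filter⁺ (λ x → part x Fin.≟ u) (∈-allFin (vertex u c)) (part-vertex u c))
               (λ {c} {c′} _ _ same → trans (sym (colour-vertex u c)) (trans (cong colour same) (colour-vertex u c′)))))
    where
    in-u : ∀ {x} → x ∈ filter (λ x → part x Fin.≟ u) (allFin N) → part x ≡ u
    in-u x∈ = proj₂ (∈-filter⁻ (λ x → part x Fin.≟ u) {xs = allFin N} x∈)

  cover : Cover l (cycleAdj l) m
  cover = record
    { N        = N
    ; adj      = adjacent
    ; part     = part
    ; irrefl   = λ x → adjacentᵛ-irrefl (part x) (colour x)
    ; sym      = λ x y → adjacentᵛ-sym (part x) (colour x) (part y) (colour y)
    ; foldSize = fibre-size
    ; clique   = clique
    ; onEdges  = onEdges
    ; matching = λ x y z x≢y y≡z x~y x~z → ≡-from-part-colour y≡z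
        (adjacentᵛ-matching (part x) (colour x) (part y) (colour y) (colour z) x≢y x~y
          (subst (λ w → adjacentᵛ (part x) (colour x) w (colour z) ≡ true) (sym y≡z) x~z))
    }
    where
    clique : ∀ x y → x ≢ y → part x ≡ part y → adjacent x y ≡ true
    clique x y x≢y same with part x Fin.≟ part y
    ... | no different = contradiction same different
    ... | yes _ with colour x Fin.≟ colour y
    ...   | yes same-colour = contradiction (≡-from-part-colour same same-colour) x≢y
    ...   | no _            = refl

    onEdges : ∀ x y → part x ≢ part y → adjacent x y ≡ true → cycleAdj l (part x) (part y) ≡ true
    onEdges x y different x~y with part x Fin.≟ part y | next (part x) Fin.≟ part y | next (part y) Fin.≟ part x
    ... | yes same | _       | _       = contradiction same different
    ... | no _     | yes fwd | _       = next⇒cycleAdj fwd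
    ... | no _     | no _    | yes bwd = next⇒cycleAdjʳ bwd

  σ-untwisted : ∀ w c → next w ≢ v₀ → σ w c ≡ c
  σ-untwisted w c w↛v₀ with next w Fin.≟ v₀
  ... | yes w→v₀ = contradiction w→v₀ w↛v₀
  ... | no  _    = refl

  σ-into-v₀ : ∀ w c → next w ≡ v₀ → σ w c ≡ (if twisted then Colour.next c else c)
  σ-into-v₀ w c w→v₀ with next w Fin.≟ v₀
  ... | yes _    = refl
  ... | no w↛v₀ = contradiction w→v₀ w↛v₀

  adjacent-forward : ∀ w {w′} c {c′} → next w ≡ w′ → σ w c ≡ c′ → adjacent (vertex w c) (vertex w′ c′) ≡ true
  adjacent-forward w {w′} c {c′} fwd shift
    rewrite part-vertex w c | colour-vertex w c | part-vertex w′ c′ | colour-vertex w′ c′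
    with w Fin.≟ w′ | next w Fin.≟ w′
  ... | yes w≡w′ | _       = contradiction (trans fwd (sym w≡w′)) (next-≢ (≤-trans (s≤s z≤n) 2≤K) w)
  ... | no _     | no ¬fwd = contradiction fwd ¬fwd
  ... | no _     | yes _ with c′ Fin.≟ σ w c
  ...   | yes _   = refl
  ...   | no c′≢ = contradiction (sym shift) c′≢

  closedBound : ℕ
  closedBound = if twisted then walksOther m (suc K) else walksSame m (suc K)

  module Rooted (s : Fin N) (s∈ : part s ≡ v₀) where
    open CoverFacts cover
    open Walks K m cover s

    private
      1≤K : 1 ≤ K
      1≤K = ≤-trans (s≤s z≤n) 2≤K

    track : ℕ → Fin N
    track k = vertex (U k) (colour s)

    vertex-of-level : ∀ k {x} → x ∈ L k → x ≡ vertex (U k) (colour x)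
    vertex-of-level k {x} x∈ = trans (sym (vertex-part-colour x)) (cong (λ w → vertex w (colour x)) (∈-fibre⁻ {U k} x∈))

    vertex∈L : ∀ k c → vertex (U k) c ∈ L k
    vertex∈L k c = ∈-fibre⁺ (part-vertex (U k) c)

    record UpperLevel (k : ℕ) : Set where
      field
        track-bounded  : #walks k (track k) ≤ walksSame m k
        others-bounded : ∀ {y} → y ∈ L k → y ≢ track k → #walks k y ≤ walksOther m k

    track-zero : track 0 ≡ s
    track-zero = vertex-part-colour s

    upper-level : ∀ k → k ≤ K → UpperLevel k
    upper-level zero _ = record
      { track-bounded  = subst (λ y → #walks 0 y ≤ 1) (sym track-zero) (≤-trans (≤-reflexive (#walks-zero s)) (walk-at-most-one s))
      ; others-bounded = λ {y} _ y≢track → ≤-reflexive (trans (#walks-zero y) (not-root y (λ y≡s → y≢track (trans y≡s (sym track-zero)))))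
      }
      where
      walk-at-most-one : ∀ y → (if does (y Fin.≟ s) then 1 else 0) ≤ 1
      walk-at-most-one y with y Fin.≟ s
      ... | yes _ = ≤-refl
      ... | no  _ = z≤n
      not-root : ∀ y → y ≢ s → (if does (y Fin.≟ s) then 1 else 0) ≡ 0
      not-root y y≢s with y Fin.≟ s
      ... | yes y≡s = contradiction y≡s y≢s
      ... | no  _   = refl
    upper-level (suc k) k<K = record
      { track-bounded  = #walks≤-via 1≤K {k} {track k} track-bounded others-bounded {track (suc k)} {vertex (U k) (colour (track (suc k)))} (part-vertex (U (suc k)) (colour s))
                           (vertex∈L k _) (upward (vertex∈L (suc k) (colour s))) (cong (vertex (U k)) (colour-vertex (U (suc k)) (colour s)))
      ; others-bounded = λ {x} x∈ x≢track → #walks≤-avoiding 1≤K {k} {track k} track-bounded others-bounded {x} {vertex (U k) (colour x)} (∈-fibre⁻ {U (suc k)} x∈)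
                           (vertex∈L k _) (upward x∈) (vertex∈L k (colour s))
                           λ same → x≢track (trans (vertex-of-level (suc k) x∈) (cong (vertex (U (suc k))) (colour-injective same)))
      }
      where
      open UpperLevel (upper-level k (<⇒≤ k<K))
      not-into-v₀ : next (U k) ≢ v₀
      not-into-v₀ eq = rotate-≢ (part s) (s≤s z≤n) (s≤s k<K) (trans eq (sym s∈))
      upward : ∀ {x} → x ∈ L (suc k) → adjacent (vertex (U k) (colour x)) x ≡ true
      upward {x} x∈ = subst (λ y → adjacent (vertex (U k) (colour x)) y ≡ true) (sym (vertex-of-level (suc k) x∈))
                        (adjacent-forward (U k) (colour x) refl (σ-untwisted (U k) (colour x) not-into-v₀))
      colour-injective : ∀ {c c′} → vertex (U k) c ≡ vertex (U k) c′ → c ≡ c′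
      colour-injective {c} {c′} same = trans (sym (colour-vertex (U k) c)) (trans (cong colour same) (colour-vertex (U k) c′))

    s∈last : part s ≡ U (suc K)
    s∈last = sym (rotate-l (part s))

    closing : ∀ c → σ (U K) c ≡ colour s → adjacent (vertex (U K) c) s ≡ true
    closing c shift = subst (λ y → adjacent (vertex (U K) c) y ≡ true) (vertex-part-colour s)
                        (adjacent-forward (U K) c (sym s∈last) shift)

    #closedWalks≤ : ∀ b → twisted ≡ b → #closedWalks ≤ (if b then walksOther m (suc K) else walksSame m (suc K))
    #closedWalks≤ true twist = #walks≤-avoiding 1≤K {K} {track K} track-bounded others-bounded {s} {vertex (U K) c′} s∈last
                   (vertex∈L K c′) (closing c′ shift) (vertex∈L K (colour s)) λ same → Colour.next-≢ 1≤M (colour s)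
                   (trans (cong Colour.next (sym (colour-same same))) (trans (sym (σ-into-v₀′)) shift))
      where
      open UpperLevel (upper-level K ≤-refl)
      c′ : Fin m
      c′ = Colour.rotate (colour s) M
      σ-into-v₀′ : σ (U K) c′ ≡ Colour.next c′
      σ-into-v₀′ rewrite σ-into-v₀ (U K) c′ (trans (sym s∈last) s∈) | twist = refl
      shift : σ (U K) c′ ≡ colour s
      shift = trans σ-into-v₀′ (Colour.rotate-l (colour s))
      colour-same : vertex (U K) c′ ≡ track K → c′ ≡ colour s
      colour-same same = trans (sym (colour-vertex (U K) c′)) (trans (cong colour same) (colour-vertex (U K) (colour s)))
    #closedWalks≤ false twist = #walks≤-via 1≤K {K} {track K} track-bounded others-bounded {s} {track K} s∈last
                    (vertex∈L K (colour s)) (closing (colour s) shift) refl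
      where
      open UpperLevel (upper-level K ≤-refl)
      shift : σ (U K) (colour s) ≡ colour s
      shift rewrite σ-into-v₀ (U K) (colour s) (trans (sym s∈last) s∈) | twist = refl

    Nr≤closedBound : Nr cover s ≤ closedBound
    Nr≤closedBound = ≤-trans Nr≤#closedWalks (#closedWalks≤ twisted refl)

  numColorings≤ : numColorings cover ≤ m * closedBound
  numColorings≤ = begin
    numColorings cover             ≤⟨ numColorings≤∑Nr v₀ ⟩
    ∑ (fibre v₀) (Nr cover)        ≤⟨ ∑-≤-const (fibre v₀) (λ s∈ → Rooted.Nr≤closedBound _ (∈-fibre⁻ s∈)) ⟩
    length (fibre v₀) * closedBound ≡⟨ cong (_* closedBound) (fibre-size v₀) ⟩
    m * closedBound                ∎
    where
    open ≤-Reasoning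
    open CoverFacts cover

P-DP-upper-bound : ∀ K M → 2 ≤ K → 1 ≤ M → ∀ {p} → IsPDP (suc K) (cycleAdj (suc K)) (suc M) p →
  p ≤ suc M * (walksSame (suc M) (suc K) ⊓ walksOther (suc M) (suc K))
P-DP-upper-bound K M 2≤K 1≤M (_ , minimal) with ≤-total (walksSame (suc M) (suc K)) (walksOther (suc M) (suc K))
... | inj₁ same≤other = ≤-trans (minimal cover) (≤-trans numColorings≤ (*-monoʳ-≤ (suc M) (≤-reflexive (sym (m≤n⇒m⊓n≡m same≤other)))))
  where open TwistedCover K M 2≤K 1≤M zero false
... | inj₂ other≤same = ≤-trans (minimal cover) (≤-trans numColorings≤ (*-monoʳ-≤ (suc M) (≤-reflexive (sym (m≥n⇒m⊓n≡n other≤same)))))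
  where open TwistedCover K M 2≤K 1≤M zero true

lemma3p7 : (l : ℕ) → 3 ≤ l → (m : ℕ) → 2 ≤ m →
    (𝓗 : Cover l (cycleAdj l) m) →
    (v : Fin l) (r : Fin (Cover.N 𝓗)) → Cover.part 𝓗 r ≡ v →
    (p : ℕ) → IsPDP l (cycleAdj l) m p →
    p ≤ m * Nr 𝓗 r
lemma3p7 (suc K@(suc (suc _))) (s≤s (s≤s (s≤s z≤n))) (suc M@(suc _)) (s≤s (s≤s z≤n)) 𝓗 _ r _ p isPDP = begin
  p                                                                ≤⟨ P-DP-upper-bound K M (s≤s (s≤s z≤n)) (s≤s z≤n) isPDP ⟩
  suc M * (walksSame (suc M) (suc K) ⊓ walksOther (suc M) (suc K)) ≤⟨ *-monoʳ-≤ (suc M) (walksSame⊓walksOther≤#closedWalks (s≤s z≤n)) ⟩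
  suc M * #closedWalks                                             ≡⟨ cong (suc M *_) (Nr≡#closedWalks (s≤s z≤n)) ⟨
  suc M * Nr 𝓗 r                                                   ∎
  where
  open ≤-Reasoning
  open Walks K (suc M) 𝓗 r
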